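{- Let $n\ge 1$ and $j\ge 1$. For a $2j$-element subset $S=\{a_1<a_2<\cdots<a_{2j}\}$ of $[n+j-1]$, define integers $b_1,\dots,b_j$ by $b_1=\max(S\cap[n])$ and, for $m=2,\dots,j$, $$b_m=\begin{cases} b_{m-1} & \text{if } n+m-1\in S,\\ \max\big([1,b_{m-1}-1]\cap S\big) & \text{otherwise},\end{cases}$$ and let $I_m=[a_m,b_m]=\{s: a_m\le s\le b_m\}$. For $m=1,\dots,j$ let $c_m$ be the map on permutations $\pi=\pi_1\cdots\pi_n$ of $[n]$ that cyclically rotates the entries in positions $a_m,\dots,b_m$: $c_m(\pi)=\tau$ with $\tau_i=\pi_i$ for $i\notin I_m$ and $\tau_{a_m}\tau_{a_m+1}\cdots\tau_{b_m}=\pi_{b_m}\pi_{a_m}\pi_{a_m+1}\cdots\pi_{b_m-1}$. Set $\phi(S)=c_j\circ c_{j-1}\circ\cdots\circ c_1(12\cdots n)$. Then $\phi$ is a well-defined bijection from the set of $2j$-element subsets of $[n+j-1]$ onto the set of permutations $\sigma\in S_n(231)$ with $\mathrm{des}(\sigma)=j$ and $\mathrm{maxdrop}(\sigma)=j$.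
   Context: For a permutation $\sigma=\sigma_1\cdots\sigma_n$ of $[n]$, $\mathrm{des}(\sigma)$ is the number of $i\in[n-1]$ with $\sigma_i>\sigma_{i+1}$, and $\mathrm{maxdrop}(\sigma)=\max\{i-\sigma_i : i\in[n]\}$. $S_n(231)$ is the set of permutations of $[n]$ with no indices $a<b<c$ such that $\sigma_c<\sigma_a<\sigma_b$. -}

module Defs where

open import Data.Nat using (ℕ; zero; suc; _+_; _*_; _∸_; _≤_; _<_; _⊔_; _≤?_; _<?_; _≟_)
open import Data.List using (List; []; _∷_; length; map; upTo; take; foldr; zipWith; zip)
open import Data.List.Relation.Unary.All using (All)
open import Data.List.Relation.Unary.Any using (any?)
open import Data.List.Relation.Unary.Linked using (Linked)
open import Data.List.Relation.Binary.Permutation.Propositional using (_↭_)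
open import Data.Maybe using (Maybe; just; nothing; _>>=_)
import Data.Maybe as Maybe
open import Data.Product using (Σ; _×_; _,_; proj₁; proj₂)
open import Data.Bool using (Bool; true; false; if_then_else_; _∨_)
open import Relation.Nullary using (¬_; does)
open import Relation.Binary.PropositionalEquality using (_≡_)

range1 : ℕ → List ℕ
range1 n = map suc (upTo n)

-- 1-indexed entry of a list (0 outside the index range)
at : List ℕ → ℕ → ℕ
at []       _             = 0
at (x ∷ xs) zero          = 0
at (x ∷ xs) (suc zero)    = x
at (x ∷ xs) (suc (suc i)) = at xs (suc i)

-- Subsets of [n+j-1] with 2j elements, as strictly increasing lists
-- a_1 < a_2 < ... < a_{2j}

IsSubset : ℕ → ℕ → List ℕ → Set
IsSubset n j S =
  Linked _<_ S × All (λ x → 1 ≤ x × x ≤ n + j ∸ 1) S × length S ≡ 2 * j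

_∈ᵇ_ : ℕ → List ℕ → Bool
x ∈ᵇ S = does (any? (x ≟_) S)

-- max (S ∩ [1,k]) (nothing if empty); elements of S are ≥ 1
maxBelow : ℕ → List ℕ → Maybe ℕ
maxBelow k [] = nothing
maxBelow k (x ∷ xs) with does (x ≤? k) | maxBelow k xs
... | true  | nothing = just x
... | true  | just m  = just (x ⊔ m)
... | false | r       = r

-- b_m, b_{m+1}, ..., b_j  (count = j - m + 1), given prev = b_{m-1}
bRest : (n : ℕ) → List ℕ → (prev m count : ℕ) → Maybe (List ℕ)
bRest n S prev m zero = just []
bRest n S prev m (suc k) =
  next >>= λ b → Maybe.map (b ∷_) (bRest n S b (suc m) k)
  where
  next : Maybe ℕ
  next = if (n + m ∸ 1) ∈ᵇ S then just prev else maxBelow (prev ∸ 1) S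

-- b_1, ..., b_j  (nothing if some max is taken over an empty set)
bSeq : ℕ → ℕ → List ℕ → Maybe (List ℕ)
bSeq n zero S = just []
bSeq n (suc k) S =
  maxBelow n S >>= λ b₁ → Maybe.map (b₁ ∷_) (bRest n S b₁ 2 k)

aSeq : ℕ → List ℕ → List ℕ
aSeq j S = take j S

rot : ℕ → ℕ → List ℕ → List ℕ
rot a b π = map τ (range1 (length π))
  where
  τ : ℕ → ℕ
  τ i = if does (i <? a) ∨ does (b <? i) then at π i
        else if does (i ≟ a) then at π b
        else at π (i ∸ 1)

-- apply c_1 first, then c_2, ..., c_j
applyRots : List (ℕ × ℕ) → List ℕ → List ℕ
applyRots [] π = π
applyRots ((a , b) ∷ ps) π = applyRots ps (rot a b π)

-- φ(S) = c_j ∘ ... ∘ c_1 (12...n); default [] if the b's are undefined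
φ : ℕ → ℕ → List ℕ → List ℕ
φ n j S with bSeq n j S
... | just bs = applyRots (zip (aSeq j S) bs) (range1 n)
... | nothing = []

WellDefined : ℕ → ℕ → List ℕ → Set
WellDefined n j S =
  Σ (List ℕ) λ bs → bSeq n j S ≡ just bs ×
    All (λ p → 1 ≤ proj₁ p × proj₁ p ≤ proj₂ p × proj₂ p ≤ n) (zip (aSeq j S) bs)

IsPerm : ℕ → List ℕ → Set
IsPerm n σ = σ ↭ range1 n

Avoids231 : List ℕ → Set
Avoids231 σ = ∀ a b c → 1 ≤ a → a < b → b < c → c ≤ length σ →
  ¬ (at σ c < at σ a × at σ a < at σ b)

des : List ℕ → ℕ
des [] = 0
des (x ∷ []) = 0
des (x ∷ y ∷ xs) = (if does (y <? x) then 1 else 0) + des (y ∷ xs)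

-- max_i (i - σ_i); truncated subtraction is harmless since for a
-- permutation the true maximum is ≥ 0
maxdrop : List ℕ → ℕ
maxdrop σ = foldr _⊔_ 0 (zipWith _∸_ (range1 (length σ)) σ)

IsTarget : ℕ → ℕ → List ℕ → Set
IsTarget n j σ = IsPerm n σ × Avoids231 σ × des σ ≡ j × maxdrop σ ≡ j

module Submission where

-- The proof goes through nests: lists of intervals [a₁,b₁], …, [a_j,b_j] in [1, n]
-- with a₁ < a₂ < … and each interval contained in (a_{m-1}, b_{m-1}].
--  * Rotations (Rotation, RotationPerm): rot a b acts on positions by an explicit
--    map ρ a b, so applyRots ps (12…n) has entry R ps i at position i, where R is the
--    composite of the ρ's; each rotation permutes the list.
--  * Nests (Nesting, Image): for a nest, R avoids 231, its descents are exactly the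
--    left endpoints and its maximal drop is the number of intervals; and R (hence
--    the permutation) determines the nest.
--  * Subsets and nests (Chain, Decode, Encode): for a 2j-subset S the b-sequence
--    exists, zip (a₁…a_j) (b₁…b_j) is a nest of j intervals, and S is recovered from
--    it; conversely every nest of j intervals arises from a subset.  The key
--    invariant is a count of the elements of S (Decode).
--  * Surjectivity (Unique, Surject): a 231-avoiding permutation is determined by its
--    descents and its values there; a target permutation is the image of the nest
--    [d_m, σ(d_m) + m - 1] built on its descents d₁ < … < d_j.
-- The theorem then combines the four parts.

open import Defs
open import Data.Nat
open import Data.Nat.Properties
open import Data.Nat.Induction using (<-rec)
open import Data.Bool using (Bool; true; false; if_then_else_; _∨_; _∧_; not; T)
open import Data.Bool.Properties using (if-float)
open import Data.Unit using (⊤; tt)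
open import Data.Empty using (⊥; ⊥-elim)
open import Data.Maybe using (just; nothing)
open import Data.Maybe.Properties using (just-injective)
open import Data.Product using (Σ; _×_; _,_; proj₁; proj₂)
open import Data.Sum using (_⊎_; inj₁; inj₂)
open import Data.List using (List; []; _∷_; length; map; upTo; applyUpTo; take; drop; foldr; zipWith; zip; unzip; _++_)
open import Data.List.Properties using (length-map; length-applyUpTo; length-zipWith; unzip-zip; length-take; take++drop≡id; length-++)
open import Data.List.Relation.Unary.All using (All; []; _∷_)
open import Data.List.Relation.Unary.AllPairs using (AllPairs; []; _∷_)
open import Data.List.Relation.Unary.Linked using (Linked)
open import Data.List.Relation.Unary.Linked.Properties using (Linked⇒AllPairs; AllPairs⇒Linked)
open import Data.List.Relation.Unary.Any using (here; there)
open import Data.List.Membership.Propositional using (_∈_)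
open import Data.List.Membership.Propositional.Properties using (∈-++⁺ʳ; ∈-++⁻)
open import Data.List.Relation.Binary.Permutation.Propositional using (_↭_; prep; swap; ↭-refl; ↭-trans; ↭-sym)
open import Data.List.Relation.Binary.Permutation.Propositional.Properties using (↭-length; ∈-resp-↭; All-resp-↭)
open import Relation.Nullary using (¬_; Dec; does; yes; no)
open import Relation.Nullary.Decidable using (dec-true; dec-false)
open import Relation.Binary.PropositionalEquality
open import Relation.Binary.Definitions using (tri<; tri≈; tri>)
import Data.List.Relation.Unary.All as All
import Data.List.Relation.Unary.AllPairs.Properties as AllPairsP
import Data.List.Relation.Unary.All.Properties as AllP
import Data.List.Relation.Unary.AllPairs as AllPairs
import Data.List.Relation.Binary.Permutation.Propositional as ↭

module ListIndex where

  at-zero : ∀ xs → at xs 0 ≡ 0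
  at-zero []       = refl
  at-zero (x ∷ xs) = refl

  at-beyond : ∀ xs i → length xs ≤ i → at xs (suc i) ≡ 0
  at-beyond []       i       _       = refl
  at-beyond (x ∷ xs) (suc i) (s≤s p) = at-beyond xs i p

  at-map : ∀ (g : ℕ → ℕ) xs i → i < length xs → at (map g xs) (suc i) ≡ g (at xs (suc i))
  at-map g (x ∷ xs) zero    _       = refl
  at-map g (x ∷ xs) (suc i) (s≤s p) = at-map g xs i p

  at-applyUpTo : ∀ (f : ℕ → ℕ) n i → i < n → at (applyUpTo f n) (suc i) ≡ f i
  at-applyUpTo f (suc n) zero    _       = refl
  at-applyUpTo f (suc n) (suc i) (s≤s p) = at-applyUpTo (λ x → f (suc x)) n i p

  at-zipWith : ∀ (g : ℕ → ℕ → ℕ) xs ys i → i < length xs → i < length ys →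
    at (zipWith g xs ys) (suc i) ≡ g (at xs (suc i)) (at ys (suc i))
  at-zipWith g (x ∷ xs) (y ∷ ys) zero    _       _       = refl
  at-zipWith g (x ∷ xs) (y ∷ ys) (suc i) (s≤s p) (s≤s q) = at-zipWith g xs ys i p q

  length-range1 : ∀ n → length (range1 n) ≡ n
  length-range1 n = trans (length-map suc (upTo n)) (length-applyUpTo (λ x → x) n)

  at-range1 : ∀ n i → i < n → at (range1 n) (suc i) ≡ suc i
  at-range1 n i p =
    trans (at-map suc (upTo n) i (subst (i <_) (sym (length-applyUpTo (λ x → x) n)) p))
          (cong suc (at-applyUpTo (λ x → x) n i p))

  at-ext : ∀ xs ys → length xs ≡ length ys →
    (∀ i → i < length xs → at xs (suc i) ≡ at ys (suc i)) → xs ≡ ys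
  at-ext []       []       _ _ = refl
  at-ext (x ∷ xs) (y ∷ ys) e f =
    cong₂ _∷_ (f 0 (s≤s z≤n)) (at-ext xs ys (suc-injective e) (λ i p → f (suc i) (s≤s p)))

  at-∈ : ∀ xs i → i < length xs → at xs (suc i) ∈ xs
  at-∈ (x ∷ xs) zero    _       = here refl
  at-∈ (x ∷ xs) (suc i) (s≤s p) = there (at-∈ xs i p)

  ∈-at : ∀ {x} xs → x ∈ xs → Σ ℕ λ i → i < length xs × at xs (suc i) ≡ x
  ∈-at (y ∷ xs) (here refl) = 0 , s≤s z≤n , refl
  ∈-at (y ∷ xs) (there p) with ∈-at xs p
  ... | i , q , e = suc i , s≤s q , e

module Rotation where

  open ListIndex

  -- The position map of the rotation c = rot a b: entry p of c(π) is entry ρ a b p of π.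
  ρ : ℕ → ℕ → ℕ → ℕ
  ρ a b i = if does (i <? a) ∨ does (b <? i) then i
            else if does (i ≟ a) then b
            else i ∸ 1

  -- Position map of applyRots ps (the rotations are applied left to right, so
  -- their position maps compose in the opposite order).
  R : List (ℕ × ℕ) → ℕ → ℕ
  R []             p = p
  R ((a , b) ∷ ps) p = ρ a b (R ps p)

  length-rot : ∀ a b π → length (rot a b π) ≡ length π
  length-rot a b π = trans (length-map _ (range1 (length π))) (length-range1 (length π))

  length-applyRots : ∀ ps π → length (applyRots ps π) ≡ length π
  length-applyRots []             π = refl
  length-applyRots ((a , b) ∷ ps) π = trans (length-applyRots ps (rot a b π)) (length-rot a b π)

  ρ-before : ∀ a b i → i < a → ρ a b i ≡ i
  ρ-before a b i p rewrite dec-true (i <? a) p = refl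

  ρ-first : ∀ a b → a ≤ b → ρ a b a ≡ b
  ρ-first a b p rewrite dec-false (a <? a) (n≮n a) | dec-false (b <? a) (≤⇒≯ p) | dec-true (a ≟ a) refl = refl

  ρ-inside : ∀ a b i → a < i → i ≤ b → ρ a b i ≡ i ∸ 1
  ρ-inside a b i p q
    rewrite dec-false (i <? a) (<⇒≯ p) | dec-false (b <? i) (≤⇒≯ q) | dec-false (i ≟ a) (λ e → <⇒≢ p (sym e)) = refl

  ρ-after : ∀ a b i → b < i → ρ a b i ≡ i
  ρ-after a b i p rewrite dec-true (b <? i) p with does (i <? a)
  ... | true  = refl
  ... | false = refl

  data RotCase (a b x : ℕ) : Set where
    before : x < a → ρ a b x ≡ x → RotCase a b x
    first  : x ≡ a → ρ a b x ≡ b → RotCase a b x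
    inside : ∀ x' → x ≡ suc x' → a < x → x ≤ b → ρ a b x ≡ x' → RotCase a b x
    after  : b < x → ρ a b x ≡ x → RotCase a b x

  rotCase : ∀ a b → a ≤ b → ∀ x → RotCase a b x
  rotCase a b ab x with <-cmp x a
  ... | tri< p _ _    = before p (ρ-before a b x p)
  ... | tri≈ _ refl _ = first refl (ρ-first a b ab)
  ... | tri> _ _ p with x ≤? b
  ... | no q = after (≰⇒> q) (ρ-after a b x (≰⇒> q))
  rotCase a b ab (suc x') | tri> _ _ p | yes q = inside x' refl p q (ρ-inside a b (suc x') p q)

  rot-at : ∀ a b π → 1 ≤ a → b ≤ length π → ∀ p → at (rot a b π) p ≡ at π (ρ a b p)
  rot-at (suc a) b π _ bl zero = trans (at-zero (rot (suc a) b π)) (sym (at-zero π))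
  rot-at a b π _ bl (suc i) with i <? length π
  ... | yes il = trans (at-map τ (range1 (length π)) i (subst (i <_) (sym (length-range1 (length π))) il))
                       (trans (cong τ (at-range1 (length π) i il)) (sym at-ρ))
    where
    τ : ℕ → ℕ
    τ k = if does (k <? a) ∨ does (b <? k) then at π k
          else if does (k ≟ a) then at π b
          else at π (k ∸ 1)
    at-ρ : at π (ρ a b (suc i)) ≡ τ (suc i)
    at-ρ = trans (if-float (at π) (does (suc i <? a) ∨ does (b <? suc i)))
                 (cong (if_then_else_ (does (suc i <? a) ∨ does (b <? suc i)) (at π (suc i)))
                       (if-float (at π) (does (suc i ≟ a))))
  ... | no il = trans (at-beyond (rot a b π) i (subst (_≤ i) (sym (length-rot a b π)) (≮⇒≥ il)))
                      (trans (sym (at-beyond π i (≮⇒≥ il)))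
                             (cong (at π) (sym (ρ-after a b (suc i) (≤-<-trans bl (s≤s (≮⇒≥ il)))))))

  InRange : ℕ → List (ℕ × ℕ) → Set
  InRange n ps = All (λ p → 1 ≤ proj₁ p × proj₂ p ≤ n) ps

  applyRots-at : ∀ ps π → InRange (length π) ps → ∀ p → at (applyRots ps π) p ≡ at π (R ps p)
  applyRots-at []             π _                p = refl
  applyRots-at ((a , b) ∷ ps) π ((a1 , bl) ∷ ab) p =
    trans (applyRots-at ps (rot a b π) (subst (λ m → InRange m ps) (sym (length-rot a b π)) ab) p)
          (rot-at a b π a1 bl (R ps p))

  ρ-strict : ∀ a b x y → a ≤ b → x ≢ a → y ≢ a → x < y → ρ a b x < ρ a b y
  ρ-strict a b x y ab xa ya xy with rotCase a b ab x | rotCase a b ab y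
  ... | first e _ | _ = ⊥-elim (xa e)
  ... | _ | first e _ = ⊥-elim (ya e)
  ... | before p e | before q f rewrite e | f = xy
  ... | before p e | inside y' refl q r f rewrite e | f = <-≤-trans p (≤-pred q)
  ... | before p e | after q f rewrite e | f = xy
  ... | inside x' refl p q e | before r f = ⊥-elim (<-asym (<-trans p xy) r)
  ... | inside x' refl p q e | inside y' refl r s f rewrite e | f = ≤-pred xy
  ... | inside x' refl p q e | after r f rewrite e | f = <-trans q r
  ... | after p e | before q f = ⊥-elim (<-asym (<-trans q (≤-<-trans ab p)) xy)
  ... | after p e | inside y' refl q r f = ⊥-elim (<⇒≱ (<-trans p xy) r)
  ... | after p e | after q f rewrite e | f = xy

  ρ-reflect : ∀ a b x y → a ≤ b → x ≢ a → y ≢ a → ρ a b x < ρ a b y → x < y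
  ρ-reflect a b x y ab xa ya p with <-cmp x y
  ... | tri< q _ _    = q
  ... | tri≈ _ refl _ = ⊥-elim (n≮n _ p)
  ... | tri> _ _ q    = ⊥-elim (<-asym p (ρ-strict a b y x ab ya xa q))

  ρ-only-a↦b : ∀ a b y → a < b → ρ a b y ≡ b → y ≡ a
  ρ-only-a↦b a b y ab e with rotCase a b (<⇒≤ ab) y
  ... | before p f         = ⊥-elim (<⇒≢ (<-trans p ab) (trans (sym f) e))
  ... | first p f          = p
  ... | inside y' refl p q f = ⊥-elim (<⇒≢ q (trans (sym f) e))
  ... | after p f          = ⊥-elim (<⇒≢ p (trans (sym e) f))

  ρ-inj : ∀ a b x y → a < b → ρ a b x ≡ ρ a b y → x ≡ y
  ρ-inj a b x y ab e with x ≟ a | y ≟ a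
  ... | yes refl | yes refl = refl
  ... | yes refl | no _ = sym (ρ-only-a↦b a b y ab (trans (sym e) (ρ-first a b (<⇒≤ ab))))
  ... | no _ | yes refl = ρ-only-a↦b a b x ab (trans e (ρ-first a b (<⇒≤ ab)))
  ... | no xa | no ya with <-cmp x y
  ... | tri< q _ _ = ⊥-elim (<⇒≢ (ρ-strict a b x y (<⇒≤ ab) xa ya q) e)
  ... | tri≈ _ q _ = q
  ... | tri> _ _ q = ⊥-elim (<⇒≢ (ρ-strict a b y x (<⇒≤ ab) ya xa q) (sym e))

  ρ-drop : ∀ a b i x → a ≤ b → i ∸ ρ a b x ≤ suc (i ∸ x)
  ρ-drop a b i x ab with rotCase a b ab x
  ... | before _ e rewrite e = n≤1+n _
  ... | after _ e rewrite e = n≤1+n _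
  ... | first refl e rewrite e = ≤-trans (∸-monoʳ-≤ i ab) (n≤1+n _)
  ... | inside x' refl _ _ e rewrite e = ∸-suc-le i x'
    where
    ∸-suc-le : ∀ m n → m ∸ n ≤ suc (m ∸ suc n)
    ∸-suc-le zero    zero    = z≤n
    ∸-suc-le zero    (suc n) = z≤n
    ∸-suc-le (suc m) zero    = ≤-refl
    ∸-suc-le (suc m) (suc n) = ∸-suc-le m n

  ρ-block : ∀ a b x → a < b → a < x → x ≤ b → a ≤ ρ a b x × ρ a b x < b
  ρ-block a b x ab ax xb with rotCase a b (<⇒≤ ab) x
  ... | before p _ = ⊥-elim (<-asym p ax)
  ... | first p _ = ⊥-elim (<⇒≢ ax (sym p))
  ... | after p _ = ⊥-elim (<⇒≱ p xb)
  ... | inside x' refl _ _ e rewrite e = ≤-pred ax , xb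

module RotationPerm where

  open ListIndex
  open Rotation

  -- rot a b is a permutation of its argument: we compare it with an explicitly
  -- recursive rotation rot′ that moves the b-th entry in front of the a-th one.

  removeAt : ℕ → List ℕ → List ℕ
  removeAt zero          xs       = xs
  removeAt (suc k)       []       = []
  removeAt (suc zero)    (x ∷ xs) = xs
  removeAt (suc (suc k)) (x ∷ xs) = x ∷ removeAt (suc k) xs

  rot′ : ℕ → ℕ → List ℕ → List ℕ
  rot′ zero          b       xs       = xs
  rot′ (suc zero)    b       xs       = at xs b ∷ removeAt b xs
  rot′ (suc (suc a)) b       []       = []
  rot′ (suc (suc a)) zero    (x ∷ xs) = x ∷ xs
  rot′ (suc (suc a)) (suc b) (x ∷ xs) = x ∷ rot′ (suc a) b xs

  length-removeAt : ∀ k xs → k < length xs → suc (length (removeAt (suc k) xs)) ≡ length xs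
  length-removeAt zero    (x ∷ xs) _       = refl
  length-removeAt (suc k) (x ∷ xs) (s≤s p) = cong suc (length-removeAt k xs p)

  length-rot′ : ∀ a b xs → 1 ≤ a → a ≤ b → b ≤ length xs → length (rot′ a b xs) ≡ length xs
  length-rot′ (suc zero)    (suc b) xs       _ _        bl       = length-removeAt b xs bl
  length-rot′ (suc (suc a)) (suc b) (x ∷ xs) _ (s≤s ab) (s≤s bl) =
    cong suc (length-rot′ (suc a) b xs (s≤s z≤n) ab bl)

  removeAt↭ : ∀ k xs → k < length xs → at xs (suc k) ∷ removeAt (suc k) xs ↭ xs
  removeAt↭ zero    (x ∷ xs) _       = ↭-refl
  removeAt↭ (suc k) (x ∷ xs) (s≤s p) = ↭-trans (swap _ _ ↭-refl) (prep x (removeAt↭ k xs p))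

  rot′↭ : ∀ a b xs → 1 ≤ a → a ≤ b → b ≤ length xs → rot′ a b xs ↭ xs
  rot′↭ (suc zero)    (suc b) xs       _ _        bl       = removeAt↭ b xs bl
  rot′↭ (suc (suc a)) (suc b) (x ∷ xs) _ (s≤s ab) (s≤s bl) = prep x (rot′↭ (suc a) b xs (s≤s z≤n) ab bl)

  at-removeAt-below : ∀ k xs i → i < k → at (removeAt (suc k) xs) (suc i) ≡ at xs (suc i)
  at-removeAt-below (suc k) (x ∷ xs) zero    _       = refl
  at-removeAt-below (suc k) (x ∷ xs) (suc i) (s≤s p) = at-removeAt-below k xs i p
  at-removeAt-below (suc k) []       i       _       = refl

  at-removeAt-above : ∀ k xs i → k ≤ i → at (removeAt (suc k) xs) (suc i) ≡ at xs (suc (suc i))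
  at-removeAt-above zero    []       i       _       = refl
  at-removeAt-above zero    (x ∷ xs) i       _       = refl
  at-removeAt-above (suc k) []       i       _       = refl
  at-removeAt-above (suc k) (x ∷ xs) (suc i) (s≤s p) = at-removeAt-above k xs i p

  ρ-shift : ∀ a b i → a ≤ b → ρ (suc a) (suc b) (suc i) ≡ suc (ρ a b i)
  ρ-shift a b i ab with rotCase a b ab i | rotCase (suc a) (suc b) (s≤s ab) (suc i)
  ... | before _ e | before _ f = trans f (cong suc (sym e))
  ... | first _ e  | first _ f  = trans f (cong suc (sym e))
  ... | inside _ refl _ _ e | inside _ refl _ _ f = trans f (cong suc (sym e))
  ... | after _ e  | after _ f  = trans f (cong suc (sym e))
  ... | before p _ | first q _  = ⊥-elim (<⇒≢ p (suc-injective q))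
  ... | before p _ | inside _ _ q _ _ = ⊥-elim (<-asym p (≤-pred q))
  ... | before p _ | after q _ = ⊥-elim (<-asym p (≤-<-trans ab (≤-pred q)))
  ... | first p _  | before q _ = ⊥-elim (<⇒≢ (≤-pred q) p)
  ... | first p _  | inside _ _ q _ _ = ⊥-elim (<⇒≢ (≤-pred q) (sym p))
  ... | first refl _ | after q _ = ⊥-elim (<⇒≱ (≤-pred q) ab)
  ... | inside _ _ p _ _ | before q _ = ⊥-elim (<-asym p (≤-pred q))
  ... | inside _ _ p _ _ | first q _ = ⊥-elim (<⇒≢ p (sym (suc-injective q)))
  ... | inside _ _ _ p _ | after q _ = ⊥-elim (<⇒≱ (≤-pred q) p)
  ... | after p _ | before q _ = ⊥-elim (<-asym (≤-<-trans ab p) (≤-pred q))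
  ... | after p _ | first refl _ = ⊥-elim (<⇒≱ p ab)
  ... | after p _ | inside _ _ _ q _ = ⊥-elim (<⇒≱ p (≤-pred q))

  ρ-positive : ∀ a b p → 1 ≤ a → a ≤ b → 1 ≤ p → 1 ≤ ρ a b p
  ρ-positive a b p a1 ab p1 with rotCase a b ab p
  ... | before _ e = subst (1 ≤_) (sym e) p1
  ... | first _ e = subst (1 ≤_) (sym e) (≤-trans a1 ab)
  ... | inside x' refl q _ e = subst (1 ≤_) (sym e) (≤-trans a1 (≤-pred q))
  ... | after _ e = subst (1 ≤_) (sym e) p1

  at-rot′ : ∀ a b xs → 1 ≤ a → a ≤ b → b ≤ length xs → ∀ i → i < length xs →
    at (rot′ a b xs) (suc i) ≡ at xs (ρ a b (suc i))
  at-rot′ (suc zero) (suc b) xs _ _ bl zero _ rewrite ρ-first 1 (suc b) (s≤s z≤n) = refl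
  at-rot′ (suc zero) (suc b) xs _ _ bl (suc i) _ with b ≤? i
  ... | yes q rewrite ρ-after 1 (suc b) (suc (suc i)) (s≤s (s≤s q)) = at-removeAt-above b xs i q
  ... | no q rewrite ρ-inside 1 (suc b) (suc (suc i)) (s≤s (s≤s z≤n)) (s≤s (≰⇒> q)) =
    at-removeAt-below b xs i (≰⇒> q)
  at-rot′ (suc (suc a)) (suc b) (x ∷ xs) _ (s≤s ab) (s≤s bl) zero _ = refl
  at-rot′ (suc (suc a)) (suc b) (x ∷ xs) _ (s≤s ab) (s≤s bl) (suc i) (s≤s il)
    rewrite ρ-shift (suc a) b (suc i) ab =
    trans (at-rot′ (suc a) b xs (s≤s z≤n) ab bl i il)
          (at-tail (ρ (suc a) b (suc i)) (ρ-positive (suc a) b (suc i) (s≤s z≤n) ab (s≤s z≤n)))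
    where
    at-tail : ∀ k → 1 ≤ k → at xs k ≡ at (x ∷ xs) (suc k)
    at-tail (suc k) _ = refl

  rot≡rot′ : ∀ a b xs → 1 ≤ a → a ≤ b → b ≤ length xs → rot a b xs ≡ rot′ a b xs
  rot≡rot′ a b xs a1 ab bl =
    at-ext (rot a b xs) (rot′ a b xs) (trans (length-rot a b xs) (sym (length-rot′ a b xs a1 ab bl)))
      (λ i il → trans (rot-at a b xs a1 bl (suc i))
                      (sym (at-rot′ a b xs a1 ab bl i (subst (i <_) (length-rot a b xs) il))))

  Intervals : ℕ → List (ℕ × ℕ) → Set
  Intervals n ps = All (λ p → 1 ≤ proj₁ p × proj₁ p ≤ proj₂ p × proj₂ p ≤ n) ps

  applyRots↭ : ∀ ps xs → Intervals (length xs) ps → applyRots ps xs ↭ xs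
  applyRots↭ []             xs _ = ↭-refl
  applyRots↭ ((a , b) ∷ ps) xs ((a1 , ab , bl) ∷ h) =
    ↭-trans (applyRots↭ ps (rot a b xs) (subst (λ m → Intervals m ps) (sym (length-rot a b xs)) h))
            (subst (_↭ xs) (sym (rot≡rot′ a b xs a1 ab bl)) (rot′↭ a b xs a1 ab bl))

module Nesting where

  open Rotation

  Nest : ℕ → ℕ → List (ℕ × ℕ) → Set
  Nest lo hi []             = ⊤
  Nest lo hi ((a , b) ∷ ps) = lo ≤ a × a < b × b ≤ hi × Nest (suc a) b ps

  As : List (ℕ × ℕ) → List ℕ
  As = map proj₁

  Bs : List (ℕ × ℕ) → List ℕ
  Bs = map proj₂

  Decr : ℕ → List ℕ → Set
  Decr hi []       = ⊤
  Decr hi (b ∷ bs) = b ≤ hi × Decr b bs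

  Decr-bounded : ∀ hi bs → Decr hi bs → All (_≤ hi) bs
  Decr-bounded hi []       _        = []
  Decr-bounded hi (b ∷ bs) (bh , D) = bh ∷ All.map (λ u → ≤-trans u bh) (Decr-bounded b bs D)

  Nest-intervals : ∀ lo hi ps → Nest lo hi ps →
    All (λ p → lo ≤ proj₁ p × proj₁ p ≤ proj₂ p × proj₂ p ≤ hi) ps
  Nest-intervals lo hi []             _                  = []
  Nest-intervals lo hi ((a , b) ∷ ps) (la , ab , bh , N) =
    (la , <⇒≤ ab , bh) ∷
    All.map (λ (u , v , w) → ≤-trans la (≤-trans (n≤1+n a) u) , v , ≤-trans w bh) (Nest-intervals (suc a) b ps N)

  Nest-As : ∀ lo hi ps → Nest lo hi ps → All (λ x → lo ≤ x × x < hi) (As ps)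
  Nest-As lo hi []             _                  = []
  Nest-As lo hi ((a , b) ∷ ps) (la , ab , bh , N) =
    (la , <-≤-trans ab bh) ∷
    All.map (λ (u , v) → ≤-trans la (≤-trans (n≤1+n a) u) , <-≤-trans v bh) (Nest-As (suc a) b ps N)

  Nest-As-sorted : ∀ lo hi ps → Nest lo hi ps → AllPairs _<_ (As ps)
  Nest-As-sorted lo hi []             _               = []
  Nest-As-sorted lo hi ((a , b) ∷ ps) (_ , _ , _ , N) =
    All.map proj₁ (Nest-As (suc a) b ps N) ∷ Nest-As-sorted (suc a) b ps N

  Nest-Bs : ∀ lo hi ps → Nest lo hi ps → All (λ b → lo < b × b ≤ hi) (Bs ps)
  Nest-Bs lo hi []             _                  = []
  Nest-Bs lo hi ((a , b) ∷ ps) (la , ab , bh , N) =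
    (≤-<-trans la ab , bh) ∷
    All.map (λ (u , v) → ≤-<-trans la (<-trans (n<1+n a) u) , ≤-trans v bh) (Nest-Bs (suc a) b ps N)

  Nest-Bs-decr : ∀ lo hi ps → Nest lo hi ps → Decr hi (Bs ps)
  Nest-Bs-decr lo hi []             _                = tt
  Nest-Bs-decr lo hi ((a , b) ∷ ps) (_ , _ , bh , N) = bh , Nest-Bs-decr (suc a) b ps N

  Nest-A<B : ∀ lo hi ps → Nest lo hi ps → ∀ a → a ∈ As ps → ∀ b → b ∈ Bs ps → a < b
  Nest-A<B lo hi ((a , b) ∷ ps) (_ , ab , _ , N) .a (here refl) .b (here refl) = ab
  Nest-A<B lo hi ((a , b) ∷ ps) (_ , ab , _ , N) .a (here refl) b' (there m) =
    <-trans (n<1+n a) (proj₁ (All.lookup (Nest-Bs (suc a) b ps N) m))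
  Nest-A<B lo hi ((a , b) ∷ ps) (_ , ab , _ , N) a' (there m) .b (here refl) =
    proj₂ (All.lookup (Nest-As (suc a) b ps N) m)
  Nest-A<B lo hi ((a , b) ∷ ps) (_ , ab , _ , N) a' (there m) b' (there m') = Nest-A<B (suc a) b ps N a' m b' m'

  zip-As-Bs : ∀ ps → zip (As ps) (Bs ps) ≡ ps
  zip-As-Bs []             = refl
  zip-As-Bs ((a , b) ∷ ps) = cong ((a , b) ∷_) (zip-As-Bs ps)

  R-below : ∀ lo hi ps → Nest lo hi ps → ∀ i → i < lo → R ps i ≡ i
  R-below lo hi []             N                i p = refl
  R-below lo hi ((a , b) ∷ ps) (q , _ , _ , N) i p
    rewrite R-below (suc a) b ps N i (≤-trans p (≤-trans q (n≤1+n a))) = ρ-before a b i (<-≤-trans p q)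

  R-above : ∀ lo hi ps → Nest lo hi ps → ∀ i → hi < i → R ps i ≡ i
  R-above lo hi []             N                i p = refl
  R-above lo hi ((a , b) ∷ ps) (_ , _ , q , N) i p
    rewrite R-above (suc a) b ps N i (≤-<-trans q p) = ρ-after a b i (≤-<-trans q p)

  R-range : ∀ lo hi ps → Nest lo hi ps → ∀ i → lo ≤ i → i ≤ hi → lo ≤ R ps i × R ps i ≤ hi
  R-range lo hi []             N                    i p q = p , q
  R-range lo hi ((a , b) ∷ ps) (la , ab , bh , N) i p q with i ≤? a | i ≤? b
  ... | yes ia | _ rewrite R-below (suc a) b ps N i (s≤s ia) with rotCase a b (<⇒≤ ab) i
  ...   | before _ e          rewrite e = p , q
  ...   | first _ e           rewrite e = ≤-trans la (<⇒≤ ab) , bh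
  ...   | inside _ refl u _ _ = ⊥-elim (<⇒≱ u ia)
  ...   | after u _           = ⊥-elim (<⇒≱ ab (≤-trans (<⇒≤ u) ia))
  R-range lo hi ((a , b) ∷ ps) (la , ab , bh , N) i p q | no _ | no ib
    rewrite R-above (suc a) b ps N i (≰⇒> ib) | ρ-after a b i (≰⇒> ib) = p , q
  R-range lo hi ((a , b) ∷ ps) (la , ab , bh , N) i p q | no ia | yes ib =
    let (u , v) = R-range (suc a) b ps N i (≰⇒> ia) ib
        (x , y) = ρ-block a b (R ps i) ab u v
    in ≤-trans la x , ≤-trans (<⇒≤ y) bh

  module Head (a b : ℕ) (ps : List (ℕ × ℕ)) (ab : a < b) (N : Nest (suc a) b ps) where

    head-before : ∀ i → i < a → R ((a , b) ∷ ps) i ≡ i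
    head-before i p rewrite R-below (suc a) b ps N i (≤-trans p (n≤1+n a)) = ρ-before a b i p

    head-first : R ((a , b) ∷ ps) a ≡ b
    head-first rewrite R-below (suc a) b ps N a ≤-refl = ρ-first a b (<⇒≤ ab)

    head-after : ∀ i → b < i → R ((a , b) ∷ ps) i ≡ i
    head-after i p rewrite R-above (suc a) b ps N i p = ρ-after a b i p

    head-block : ∀ i → a < i → i ≤ b → a ≤ R ((a , b) ∷ ps) i × R ((a , b) ∷ ps) i < b
    head-block i p q = let (u , v) = R-range (suc a) b ps N i p q in ρ-block a b (R ps i) ab u v

    tail≢a : ∀ i → i ≢ a → R ps i ≢ a
    tail≢a i ia with <-cmp i a | i ≤? b
    ... | tri< p _ _ | _ rewrite R-below (suc a) b ps N i (≤-trans p (n≤1+n a)) = ia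
    ... | tri≈ _ p _ | _ = ⊥-elim (ia p)
    ... | tri> _ _ p | yes q = λ e → <⇒≢ (proj₁ (R-range (suc a) b ps N i p q)) (sym e)
    ... | tri> _ _ p | no q rewrite R-above (suc a) b ps N i (≰⇒> q) = ia

  Avoids231ᶠ : (ℕ → ℕ) → Set
  Avoids231ᶠ f = ∀ p q r → p < q → q < r → f r < f p → f p < f q → ⊥

  -- The position map of a nest avoids 231.  If none of p, q, r is the first left
  -- endpoint a, the pattern would already occur for the rest of the nest (ρ a b
  -- preserves and reflects the order away from a); if one of them is a, the block
  -- structure of the head interval rules the pattern out directly.
  R-avoids231 : ∀ lo hi ps → Nest lo hi ps → Avoids231ᶠ (R ps)
  R-avoids231 lo hi []             N                p q r pq qr x y = <-asym (<-trans pq qr) x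
  R-avoids231 lo hi ((a , b) ∷ ps) (_ , ab , _ , N) p q r pq qr x y with p ≟ a | q ≟ a | r ≟ a
  ... | no pa | no qa | no ra =
    R-avoids231 (suc a) b ps N p q r pq qr
      (ρ-reflect a b _ _ (<⇒≤ ab) (tail≢a r ra) (tail≢a p pa) x)
      (ρ-reflect a b _ _ (<⇒≤ ab) (tail≢a p pa) (tail≢a q qa) y)
    where open Head a b ps ab N
  ... | yes refl | _ | _ with q ≤? b
  ...   | yes qb = <-asym (subst (_< R ((a , b) ∷ ps) q) head-first y) (proj₂ (head-block q pq qb))
    where open Head a b ps ab N
  ...   | no qb rewrite Head.head-after a b ps ab N r (<-trans (≰⇒> qb) qr) | Head.head-first a b ps ab N =
    <-asym x (<-trans (≰⇒> qb) qr)
  R-avoids231 lo hi ((a , b) ∷ ps) (_ , ab , _ , N) p q r pq qr x y | _ | yes refl | _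
    rewrite Head.head-before a b ps ab N p pq with r ≤? b
  ... | yes rb = <⇒≱ x (≤-trans (<⇒≤ pq) (proj₁ (Head.head-block a b ps ab N r qr rb)))
  ... | no rb rewrite Head.head-after a b ps ab N r (≰⇒> rb) = <-asym x (<-trans pq qr)
  R-avoids231 lo hi ((a , b) ∷ ps) (_ , ab , _ , N) p q r pq qr x y | _ | _ | yes refl
    rewrite Head.head-before a b ps ab N p (<-trans pq qr) | Head.head-first a b ps ab N =
    <-asym x (<-trans (<-trans pq qr) ab)

  descent⇒left-endpoint : ∀ lo hi ps → Nest lo hi ps → ∀ i → R ps (suc i) < R ps i → i ∈ As ps
  descent⇒left-endpoint lo hi []             N                i d = ⊥-elim (<-asym d (n<1+n i))
  descent⇒left-endpoint lo hi ((a , b) ∷ ps) (_ , ab , _ , N) i d with i ≟ a | suc i ≟ a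
  ... | yes refl | _ = here refl
  ... | no _ | yes refl rewrite Head.head-before a b ps ab N i ≤-refl | Head.head-first a b ps ab N =
    ⊥-elim (<-asym d (<-trans (n<1+n i) ab))
  ... | no ia | no sia =
    there (descent⇒left-endpoint (suc a) b ps N i (ρ-reflect a b _ _ (<⇒≤ ab) (tail≢a (suc i) sia) (tail≢a i ia) d))
    where open Head a b ps ab N

  left-endpoint⇒descent : ∀ lo hi ps → Nest lo hi ps → ∀ i → i ∈ As ps → R ps (suc i) < R ps i
  left-endpoint⇒descent lo hi ((a , b) ∷ ps) (_ , ab , _ , N) i (here refl)
    rewrite Head.head-first a b ps ab N = proj₂ (Head.head-block a b ps ab N (suc i) ≤-refl ab)
  left-endpoint⇒descent lo hi ((a , b) ∷ ps) (_ , ab , _ , N) i (there m) =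
    ρ-strict a b _ _ (<⇒≤ ab) (tail≢a (suc i) (λ e → <⇒≢ (≤-trans ai (n≤1+n i)) (sym e)))
                             (tail≢a i (λ e → <⇒≢ ai (sym e)))
                             (left-endpoint⇒descent (suc a) b ps N i m)
    where
    open Head a b ps ab N
    ai : a < i
    ai = proj₁ (All.lookup (Nest-As (suc a) b ps N) m)

  -- A nest is determined by its position map: the descents give the left endpoints,
  -- the image of the first left endpoint is the first right endpoint, and the rest
  -- is recovered by cancelling the first (injective) rotation.
  R-injective : ∀ lo hi ps qs → Nest lo hi ps → Nest lo hi qs → (∀ i → R ps i ≡ R qs i) → ps ≡ qs
  R-injective lo hi [] [] _ _ e = refl
  R-injective lo hi [] ((a , b) ∷ qs) _ M e =
    ⊥-elim (<-asym (subst₂ _<_ (sym (e (suc a))) (sym (e a)) (left-endpoint⇒descent lo hi _ M a (here refl))) (n<1+n a))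
  R-injective lo hi ((a , b) ∷ ps) [] N _ e =
    ⊥-elim (<-asym (subst₂ _<_ (e (suc a)) (e a) (left-endpoint⇒descent lo hi _ N a (here refl))) (n<1+n a))
  R-injective lo hi ((a , b) ∷ ps) ((a′ , b′) ∷ qs) N@(_ , ab , _ , N′) M@(_ , ab′ , _ , M′) e
    with ≤-antisym (first-least N a′ (transfer M N (λ i → sym (e i))))
                   (first-least M a (transfer N M e))
    where
    first-least : ∀ {a b ps} → Nest lo hi ((a , b) ∷ ps) → ∀ x → x ∈ As ((a , b) ∷ ps) → a ≤ x
    first-least {a} {b} {ps} (_ , _ , _ , N) x (here refl) = ≤-refl
    first-least {a} {b} {ps} (_ , _ , _ , N) x (there m) =
      ≤-trans (n≤1+n a) (proj₁ (All.lookup (Nest-As (suc a) b ps N) m))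
    transfer : ∀ {x y ps qs} → Nest lo hi ((x , y) ∷ ps) → Nest lo hi qs →
               (∀ i → R ((x , y) ∷ ps) i ≡ R qs i) → x ∈ As qs
    transfer {x} {qs = qs} P Q e′ =
      descent⇒left-endpoint lo hi qs Q x (subst₂ _<_ (e′ (suc x)) (e′ x) (left-endpoint⇒descent lo hi _ P x (here refl)))
  ... | refl with trans (sym (Head.head-first a b ps ab N′)) (trans (e a) (Head.head-first a b′ qs ab′ M′))
  ... | refl = cong ((a , b) ∷_) (R-injective (suc a) b ps qs N′ M′ (λ i → ρ-inj a b _ _ ab (e i)))

  R-drop≤length : ∀ lo hi ps → Nest lo hi ps → ∀ i → i ∸ R ps i ≤ length ps
  R-drop≤length lo hi []             N                i = ≤-reflexive (n∸n≡0 i)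
  R-drop≤length lo hi ((a , b) ∷ ps) (_ , ab , _ , N) i =
    ≤-trans (ρ-drop a b i (R ps i) (<⇒≤ ab)) (s≤s (R-drop≤length (suc a) b ps N i))

  -- The bound is attained at w = (last left endpoint) + 1, which every rotation moves one step back.
  maxdrop-position : List (ℕ × ℕ) → ℕ
  maxdrop-position []                 = 0
  maxdrop-position ((a , b) ∷ [])     = suc a
  maxdrop-position ((a , b) ∷ p ∷ ps) = maxdrop-position (p ∷ ps)

  maxdrop-position-ok : ∀ lo hi a b ps → Nest lo hi ((a , b) ∷ ps) →
    let w = maxdrop-position ((a , b) ∷ ps) in
    a < w × w ≤ b × R ((a , b) ∷ ps) w + length ((a , b) ∷ ps) ≡ w
  maxdrop-position-ok lo hi a b [] (_ , ab , _ , _) =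
    ≤-refl , ab , trans (cong (_+ 1) (ρ-inside a b (suc a) ≤-refl ab)) (+-comm a 1)
  maxdrop-position-ok lo hi a b ((a′ , b′) ∷ ps) (_ , ab , _ , N@(la′ , _ , b′b , _))
    with maxdrop-position-ok (suc a) b a′ b′ ps N
  ... | (u , v , w) with R-range (suc a) b ((a′ , b′) ∷ ps) N (maxdrop-position ((a′ , b′) ∷ ps))
                          (≤-trans la′ (<⇒≤ u)) (≤-trans v b′b)
  ... | (r1 , r2) with rotCase a b (<⇒≤ ab) (R ((a′ , b′) ∷ ps) (maxdrop-position ((a′ , b′) ∷ ps)))
  ... | before z _ = ⊥-elim (<⇒≱ z (≤-trans (n≤1+n a) r1))
  ... | first z _ = ⊥-elim (<⇒≢ r1 (sym z))
  ... | after z _ = ⊥-elim (<⇒≱ z r2)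
  ... | inside x′ e _ _ f =
    ≤-trans la′ (<⇒≤ u) , ≤-trans v b′b ,
    trans (cong (_+ suc (length ((a′ , b′) ∷ ps))) f)
          (trans (+-suc x′ _) (trans (cong (_+ length ((a′ , b′) ∷ ps)) (sym e)) w))

  R-drop-attained : ∀ n ps → Nest 1 n ps →
    length ps ≡ 0 ⊎ Σ ℕ λ i → i < n × suc i ∸ R ps (suc i) ≡ length ps
  R-drop-attained n []             N = inj₁ refl
  R-drop-attained n ((a , b) ∷ ps) N@(_ , _ , bn , _) with maxdrop-position-ok 1 n a b ps N
  ... | (u , v , w) with maxdrop-position ((a , b) ∷ ps)
  ... | suc i = inj₂ (i , ≤-trans v bn , ∸-from w)
    where
    ∸-from : ∀ {x y z} → x + y ≡ z → z ∸ x ≡ y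
    ∸-from {x} {y} refl = m+n∸m≡n x y

  zip-Nest : ∀ lo hi c A B → AllPairs _<_ A → All (λ a → lo ≤ a × a ≤ c) A → All (c <_) B → Decr hi B →
    length A ≡ length B → Nest lo hi (zip A B)
  zip-Nest lo hi c []      []      _        _                  _          _        _ = tt
  zip-Nest lo hi c (a ∷ A) (b ∷ B) (h ∷ ap) ((la , ac) ∷ bdA) (cb ∷ cB) (bh , D) e =
    la , ≤-<-trans ac cb , bh ,
    zip-Nest (suc a) b c A B ap (All.zipWith (λ (ax , (_ , xc)) → ax , xc) (h , bdA)) cB D (suc-injective e)

module Counting where

  <⇒≤∸1 : ∀ z p → z < p → z ≤ p ∸ 1
  <⇒≤∸1 z (suc p) q = ≤-pred q

  ∸1< : ∀ p → 1 ≤ p → p ∸ 1 < p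
  ∸1< (suc p) _ = ≤-refl

  suc∸1 : ∀ p → 1 ≤ p → suc (p ∸ 1) ≡ p
  suc∸1 (suc p) _ = refl

  <∸1⇒suc< : ∀ i n → i < n ∸ 1 → suc i < n
  <∸1⇒suc< i (suc n) p = s≤s p

  next-index : ∀ n m y → n + m ∸ 1 ≡ suc y → n + suc m ∸ 1 ≡ suc (suc y)
  next-index n m y e = trans (cong (_∸ 1) (+-suc n m)) (lemma (n + m) e)
    where
    lemma : ∀ x → x ∸ 1 ≡ suc y → suc x ∸ 1 ≡ suc (suc y)
    lemma (suc x) e = cong suc e

  n+2∸1 : ∀ n → n + 2 ∸ 1 ≡ suc n
  n+2∸1 n = cong (_∸ 1) (trans (+-suc n 1) (cong suc (+-comm n 1)))

  bool-iff : ∀ {b c : Bool} → (b ≡ true → c ≡ true) → (c ≡ true → b ≡ true) → b ≡ c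
  bool-iff {true}  {true}  f g = refl
  bool-iff {true}  {false} f g = sym (f refl)
  bool-iff {false} {true}  f g = g refl
  bool-iff {false} {false} f g = refl

  ∨-true : ∀ a b → a ∨ b ≡ true → a ≡ true ⊎ b ≡ true
  ∨-true true  b e = inj₁ refl
  ∨-true false b e = inj₂ e

  ∧-true : ∀ a b → a ∧ b ≡ true → a ≡ true × b ≡ true
  ∧-true true true e = refl , refl

  ∨-true-right : ∀ a → a ∨ true ≡ true
  ∨-true-right true  = refl
  ∨-true-right false = refl

  does-true : ∀ {P : Set} (d : Dec P) → does d ≡ true → P
  does-true (yes p) _ = p

  <?-sound : ∀ m n → does (m <? n) ≡ true → m < n
  <?-sound m n = does-true (m <? n)

  ≟-sound : ∀ x y → does (x ≟ y) ≡ true → x ≡ y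
  ≟-sound x y = does-true (x ≟ y)

  ∈ᵇ⇒∈ : ∀ x ys → x ∈ᵇ ys ≡ true → x ∈ ys
  ∈ᵇ⇒∈ x (y ∷ ys) = by-head (x ≟ y)
    where
    by-head : (d : Dec (x ≡ y)) → (does d ∨ x ∈ᵇ ys) ≡ true → x ∈ y ∷ ys
    by-head (yes p) _ = here p
    by-head (no _)  e = there (∈ᵇ⇒∈ x ys e)

  ∈⇒∈ᵇ : ∀ x ys → x ∈ ys → x ∈ᵇ ys ≡ true
  ∈⇒∈ᵇ x (y ∷ ys) = by-head (x ≟ y)
    where
    by-head : (d : Dec (x ≡ y)) → x ∈ y ∷ ys → (does d ∨ x ∈ᵇ ys) ≡ true
    by-head (yes _)  _         = refl
    by-head (no ne)  (here p)  = ⊥-elim (ne p)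
    by-head (no _)   (there m) = ∈⇒∈ᵇ x ys m

  ∉⇒∈ᵇ : ∀ x ys → ¬ (x ∈ ys) → x ∈ᵇ ys ≡ false
  ∉⇒∈ᵇ x ys n with x ∈ᵇ ys in e
  ... | true  = ⊥-elim (n (∈ᵇ⇒∈ x ys e))
  ... | false = refl

  restrict : ∀ {P : ℕ → Set} k → (∀ i → 1 ≤ i → i ≤ suc k → P i) → ∀ i → 1 ≤ i → i ≤ k → P i
  restrict k f i a b = f i a (≤-trans b (n≤1+n k))

  ind : Bool → ℕ
  ind b = if b then 1 else 0

  cnt : (ℕ → Bool) → ℕ → ℕ
  cnt p zero    = 0
  cnt p (suc k) = cnt p k + ind (p (suc k))

  cnt-ext : ∀ p q k → (∀ i → i < k → p (suc i) ≡ q (suc i)) → cnt p k ≡ cnt q k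
  cnt-ext p q zero    e = refl
  cnt-ext p q (suc k) e = cong₂ _+_ (cnt-ext p q k (λ i il → e i (≤-trans il (n≤1+n k)))) (cong ind (e k ≤-refl))

  cnt-shift : ∀ p k → cnt p (suc k) ≡ ind (p 1) + cnt (λ i → p (suc i)) k
  cnt-shift p zero    = +-comm 0 (ind (p 1))
  cnt-shift p (suc k) = trans (cong (_+ ind (p (suc (suc k)))) (cnt-shift p k)) (+-assoc (ind (p 1)) _ _)

  cnt-∨ : ∀ p q k → (∀ i → p i ≡ true → q i ≡ false) → cnt (λ i → p i ∨ q i) k ≡ cnt p k + cnt q k
  cnt-∨ p q zero    d = refl
  cnt-∨ p q (suc k) d =
    trans (cong₂ _+_ (cnt-∨ p q k d) (ind-∨ (p (suc k)) (q (suc k)) (d (suc k))))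
          (+-exchange (cnt p k) (cnt q k) _ _)
    where
    ind-∨ : ∀ b c → (b ≡ true → c ≡ false) → ind (b ∨ c) ≡ ind b + ind c
    ind-∨ true  true  d with d refl
    ... | ()
    ind-∨ true  false d = refl
    ind-∨ false c     d = refl
    +-exchange : ∀ P Q x y → (P + Q) + (x + y) ≡ (P + x) + (Q + y)
    +-exchange P Q x y = trans (+-assoc P Q (x + y)) (trans (cong (P +_) (trans (sym (+-assoc Q x y))
      (trans (cong (_+ y) (+-comm Q x)) (+-assoc x Q y)))) (sym (+-assoc P x (Q + y))))

  cnt-none : ∀ p k → (∀ i → i < k → p (suc i) ≡ false) → cnt p k ≡ 0
  cnt-none p zero    e = refl
  cnt-none p (suc k) e rewrite cnt-none p k (λ i il → e i (≤-trans il (n≤1+n k))) | e k ≤-refl = refl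

  cnt-all : ∀ p k → (∀ i → 1 ≤ i → i ≤ k → p i ≡ true) → cnt p k ≡ k
  cnt-all p zero    f = refl
  cnt-all p (suc k) f rewrite f (suc k) (s≤s z≤n) ≤-refl | cnt-all p k (restrict k f) =
    +-comm k 1

  cnt-single : ∀ x k → 1 ≤ x → x ≤ k → cnt (λ i → does (i ≟ x)) k ≡ 1
  cnt-single zero    zero    () _
  cnt-single (suc x) zero    _  ()
  cnt-single x (suc k) x1 xk with suc k ≟ x
  ... | yes refl rewrite cnt-none (λ i → does (i ≟ suc k)) k
                           (λ i il → dec-false (suc i ≟ suc k) (λ e → <⇒≢ (s≤s il) e))
                       | dec-true (suc k ≟ suc k) refl = refl
  ... | no ne rewrite cnt-single x k x1 (≤-pred (≤∧≢⇒< xk (λ e → ne (sym e)))) | dec-false (suc k ≟ x) ne = refl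

  cnt-members : ∀ X k → AllPairs _<_ X → All (λ x → 1 ≤ x × x ≤ k) X → cnt (λ i → i ∈ᵇ X) k ≡ length X
  cnt-members []      k _        _                 = cnt-none _ k (λ _ _ → refl)
  cnt-members (x ∷ X) k (h ∷ ap) ((x1 , xk) ∷ bs) =
    trans (cnt-∨ (λ i → does (i ≟ x)) (λ i → i ∈ᵇ X) k disjoint)
          (cong₂ _+_ (cnt-single x k x1 xk) (cnt-members X k ap bs))
    where
    disjoint : ∀ i → does (i ≟ x) ≡ true → i ∈ᵇ X ≡ false
    disjoint i e with ≟-sound i x e
    ... | refl = ∉⇒∈ᵇ i X (λ m → <-irrefl refl (All.lookup h m))

  cnt-mono : ∀ p x y → x ≤ y → cnt p x ≤ cnt p y
  cnt-mono p x zero    z≤n = ≤-refl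
  cnt-mono p x (suc y) q with m≤n⇒m<n∨m≡n q
  ... | inj₂ refl = ≤-refl
  ... | inj₁ r    = ≤-trans (cnt-mono p x y (≤-pred r)) (m≤m+n _ _)

  cnt-hit : ∀ p y → p (suc y) ≡ true → cnt p (suc y) ≡ suc (cnt p y)
  cnt-hit p y e rewrite e = +-comm _ 1

  cnt-gap : ∀ p b y → b ≤ y → (∀ i → b < i → i ≤ y → p i ≡ false) → cnt p y ≡ cnt p b
  cnt-gap p b zero    z≤n f = refl
  cnt-gap p b (suc y) q f with m≤n⇒m<n∨m≡n q
  ... | inj₂ refl = refl
  ... | inj₁ r rewrite f (suc y) r ≤-refl =
    trans (+-identityʳ _) (cnt-gap p b y (≤-pred r) (λ i u v → f i u (≤-trans v (n≤1+n y))))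

  ind-le : ∀ a b → (a ≡ true → b ≡ true) → ind a ≤ ind b
  ind-le true  b f rewrite f refl = ≤-refl
  ind-le false b f = z≤n

  cnt-le : ∀ p q k → (∀ i → 1 ≤ i → i ≤ k → p i ≡ true → q i ≡ true) → cnt p k ≤ cnt q k
  cnt-le p q zero    f = z≤n
  cnt-le p q (suc k) f =
    +-mono-≤ (cnt-le p q k (restrict k f)) (ind-le _ _ (f (suc k) (s≤s z≤n) ≤-refl))

  cnt-le-eq : ∀ p q k → (∀ i → 1 ≤ i → i ≤ k → p i ≡ true → q i ≡ true) → cnt q k ≤ cnt p k →
    ∀ i → 1 ≤ i → i ≤ k → q i ≡ true → p i ≡ true
  cnt-le-eq p q zero    f le i i1 ik qi = ⊥-elim (<⇒≱ i1 ik)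
  cnt-le-eq p q (suc k) f le i i1 ik qi with m≤n⇒m<n∨m≡n ik
  ... | inj₂ refl = ind-le-rev (p (suc k)) (q (suc k)) last qi
    where
    last : ind (q (suc k)) ≤ ind (p (suc k))
    last = +-cancelˡ-≤ (cnt q k) _ _ (≤-trans le (+-monoˡ-≤ _ (cnt-le p q k (restrict k f))))
    ind-le-rev : ∀ a b → ind b ≤ ind a → b ≡ true → a ≡ true
    ind-le-rev true  b     _  _ = refl
    ind-le-rev false true  () _
  ... | inj₁ lt = cnt-le-eq p q k (restrict k f) earlier i i1 (≤-pred lt) qi
    where
    earlier : cnt q k ≤ cnt p k
    earlier = +-cancelʳ-≤ (ind (q (suc k))) _ _
                (≤-trans le (+-monoʳ-≤ (cnt p k) (ind-le _ _ (f (suc k) (s≤s z≤n) ≤-refl))))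

  select : (ℕ → Bool) → List ℕ → List ℕ
  select p []       = []
  select p (x ∷ xs) = if p x then x ∷ select p xs else select p xs

  rng : ℕ → ℕ → List ℕ
  rng lo zero    = []
  rng lo (suc k) = lo ∷ rng (suc lo) k

  select-∈⁻ : ∀ p xs {x} → x ∈ select p xs → x ∈ xs × p x ≡ true
  select-∈⁻ p (y ∷ xs) {x} m with p y in e | m
  ... | true  | here refl = here refl , e
  ... | true  | there m′ = let (a , b) = select-∈⁻ p xs m′ in there a , b
  ... | false | m′       = let (a , b) = select-∈⁻ p xs m′ in there a , b

  select-∈⁺ : ∀ p xs {x} → x ∈ xs → p x ≡ true → x ∈ select p xs
  select-∈⁺ p (y ∷ xs) (here refl) e rewrite e = here refl
  select-∈⁺ p (y ∷ xs) (there m) e with p y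
  ... | true  = there (select-∈⁺ p xs m e)
  ... | false = select-∈⁺ p xs m e

  select-sorted : ∀ p xs → AllPairs _<_ xs → AllPairs _<_ (select p xs)
  select-sorted p []       _        = []
  select-sorted p (x ∷ xs) (h ∷ ap) with p x
  ... | true  = All.tabulate (λ m → All.lookup h (proj₁ (select-∈⁻ p xs m))) ∷ select-sorted p xs ap
  ... | false = select-sorted p xs ap

  rng-∈⁻ : ∀ lo k {x} → x ∈ rng lo k → lo ≤ x × x < lo + k
  rng-∈⁻ lo (suc k) (here refl) = ≤-refl , m<m+n lo (s≤s z≤n)
  rng-∈⁻ lo (suc k) {x} (there m) with rng-∈⁻ (suc lo) k m
  ... | (u , v) = <⇒≤ u , subst (x <_) (sym (+-suc lo k)) v

  rng-∈⁺ : ∀ lo k x → lo ≤ x → x < lo + k → x ∈ rng lo k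
  rng-∈⁺ lo zero    x p q = ⊥-elim (<⇒≱ q (subst (_≤ x) (sym (+-identityʳ lo)) p))
  rng-∈⁺ lo (suc k) x p q with lo ≟ x
  ... | yes refl = here refl
  ... | no ne    = there (rng-∈⁺ (suc lo) k x (≤∧≢⇒< p ne) (subst (x <_) (+-suc lo k) q))

  rng-sorted : ∀ lo k → AllPairs _<_ (rng lo k)
  rng-sorted lo zero    = []
  rng-sorted lo (suc k) = All.tabulate (λ m → proj₁ (rng-∈⁻ (suc lo) k m)) ∷ rng-sorted (suc lo) k

  length-select-rng : ∀ Q k → length (select Q (rng 1 k)) ≡ cnt Q k
  length-select-rng Q k = trans (from 1 k) (sym (split 0 k))
    where
    sumFrom : ℕ → ℕ → ℕ
    sumFrom lo zero    = 0
    sumFrom lo (suc k) = ind (Q lo) + sumFrom (suc lo) k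
    from : ∀ lo k → length (select Q (rng lo k)) ≡ sumFrom lo k
    from lo zero = refl
    from lo (suc k) with Q lo
    ... | true  = cong suc (from (suc lo) k)
    ... | false = from (suc lo) k
    split : ∀ lo k → cnt Q (lo + k) ≡ cnt Q lo + sumFrom (suc lo) k
    split lo zero    = trans (cong (cnt Q) (+-identityʳ lo)) (sym (+-identityʳ _))
    split lo (suc k) = trans (cong (cnt Q) (+-suc lo k)) (trans (split (suc lo) k) (+-assoc (cnt Q lo) _ _))

  -- Pigeonhole: if h maps the positions i ∈ [1, m] with q i injectively into [1, K],
  -- there are at most K of them.  (Induction on m; the value h m is swapped with K.)
  pigeonhole : ∀ m (q : ℕ → Bool) (h : ℕ → ℕ) K →
    (∀ i → 1 ≤ i → i ≤ m → q i ≡ true → 1 ≤ h i × h i ≤ K) →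
    (∀ i i′ → 1 ≤ i → i ≤ m → 1 ≤ i′ → i′ ≤ m → q i ≡ true → q i′ ≡ true → h i ≡ h i′ → i ≡ i′) →
    cnt q m ≤ K
  pigeonhole zero    q h K B I = z≤n
  pigeonhole (suc m) q h K B I with q (suc m) in e
  ... | false = subst (_≤ K) (sym (+-identityʳ _))
                  (pigeonhole m q h K (restrict m B)
                     (λ i i′ a b c d → I i i′ a (≤-trans b (n≤1+n m)) c (≤-trans d (n≤1+n m))))
  ... | true with B (suc m) (s≤s z≤n) ≤-refl e
  ...   | (y1 , yK) with K
  ...     | zero = ⊥-elim (<⇒≱ y1 yK)
  ...     | suc K′ = subst (_≤ suc K′) (+-comm 1 _) (s≤s (pigeonhole m q h′ K′ B′ I′))
    where
    y : ℕ
    y = h (suc m)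
    I↓ : ∀ i i′ → 1 ≤ i → i ≤ m → 1 ≤ i′ → i′ ≤ m → q i ≡ true → q i′ ≡ true → h i ≡ h i′ → i ≡ i′
    I↓ i i′ a b c d = I i i′ a (≤-trans b (n≤1+n m)) c (≤-trans d (n≤1+n m))
    misses-y : ∀ i → 1 ≤ i → i ≤ m → q i ≡ true → h i ≢ y
    misses-y i a b qi hy = <-irrefl (I i (suc m) a (≤-trans b (n≤1+n m)) (s≤s z≤n) ≤-refl qi e hy) (s≤s b)
    -- h with the value suc K′ redirected to the freed value y
    h′ : ℕ → ℕ
    h′ i = if does (h i ≟ suc K′) then y else h i
    h′-hit : ∀ i → h i ≡ suc K′ → h′ i ≡ y
    h′-hit i hk rewrite dec-true (h i ≟ suc K′) hk = refl
    h′-miss : ∀ i → h i ≢ suc K′ → h′ i ≡ h i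
    h′-miss i hk rewrite dec-false (h i ≟ suc K′) hk = refl
    B′ : ∀ i → 1 ≤ i → i ≤ m → q i ≡ true → 1 ≤ h′ i × h′ i ≤ K′
    B′ i a b qi with h i ≟ suc K′
    ... | yes hk rewrite h′-hit i hk = y1 , ≤-pred (≤∧≢⇒< yK (λ yk → misses-y i a b qi (trans hk (sym yk))))
    ... | no hk rewrite h′-miss i hk = let (u , v) = restrict m B i a b qi in u , ≤-pred (≤∧≢⇒< v hk)
    I′ : ∀ i i′ → 1 ≤ i → i ≤ m → 1 ≤ i′ → i′ ≤ m → q i ≡ true → q i′ ≡ true → h′ i ≡ h′ i′ → i ≡ i′
    I′ i i′ a b c d qi qi′ eq with h i ≟ suc K′ | h i′ ≟ suc K′
    ... | yes hk | yes hk′ = I↓ i i′ a b c d qi qi′ (trans hk (sym hk′))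
    ... | yes hk | no hk′  =
      ⊥-elim (misses-y i′ c d qi′ (sym (trans (sym (h′-hit i hk)) (trans eq (h′-miss i′ hk′)))))
    ... | no hk  | yes hk′ =
      ⊥-elim (misses-y i a b qi (trans (sym (h′-miss i hk)) (trans eq (h′-hit i′ hk′))))
    ... | no hk  | no hk′  = I↓ i i′ a b c d qi qi′ (trans (sym (h′-miss i hk)) (trans eq (h′-miss i′ hk′)))

module Statistics where

  open ListIndex
  open Counting

  isDescent : List ℕ → ℕ → Bool
  isDescent σ i = does (at σ (suc i) <? at σ i)

  des≡cnt : ∀ σ → des σ ≡ cnt (isDescent σ) (length σ ∸ 1)
  des≡cnt []           = refl
  des≡cnt (x ∷ [])     = refl
  des≡cnt (x ∷ y ∷ xs) =
    trans (cong (ind (does (y <? x)) +_)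
                (trans (des≡cnt (y ∷ xs))
                       (cnt-ext (isDescent (y ∷ xs)) (λ i → isDescent (x ∷ y ∷ xs) (suc i)) (length xs) (λ i _ → refl))))
          (sym (cnt-shift (isDescent (x ∷ y ∷ xs)) (length xs)))

  drops : List ℕ → List ℕ
  drops σ = zipWith _∸_ (range1 (length σ)) σ

  length-drops : ∀ σ → length (drops σ) ≡ length σ
  length-drops σ =
    trans (length-zipWith _∸_ (range1 (length σ)) σ)
          (trans (cong (_⊓ length σ) (length-range1 (length σ))) (⊓-idem (length σ)))

  at-drops : ∀ σ i → i < length σ → at (drops σ) (suc i) ≡ suc i ∸ at σ (suc i)
  at-drops σ i p =
    trans (at-zipWith _∸_ (range1 (length σ)) σ i (subst (i <_) (sym (length-range1 _)) p) p)
          (cong (_∸ at σ (suc i)) (at-range1 (length σ) i p))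

  max-upper : ∀ L i → i < length L → at L (suc i) ≤ foldr _⊔_ 0 L
  max-upper (x ∷ L) zero    _       = m≤m⊔n x _
  max-upper (x ∷ L) (suc i) (s≤s p) = ≤-trans (max-upper L i p) (m≤n⊔m x _)

  max-least : ∀ L B → (∀ i → i < length L → at L (suc i) ≤ B) → foldr _⊔_ 0 L ≤ B
  max-least []      B f = z≤n
  max-least (x ∷ L) B f = ⊔-lub (f 0 (s≤s z≤n)) (max-least L B (λ i p → f (suc i) (s≤s p)))

  max-attained : ∀ L → foldr _⊔_ 0 L ≡ 0 ⊎ Σ ℕ λ i → i < length L × at L (suc i) ≡ foldr _⊔_ 0 L
  max-attained []      = inj₁ refl
  max-attained (x ∷ L) with ⊔-sel x (foldr _⊔_ 0 L)
  ... | inj₁ e = inj₂ (0 , s≤s z≤n , sym e)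
  ... | inj₂ e with max-attained L
  ...   | inj₁ z = inj₁ (trans e z)
  ...   | inj₂ (i , p , q) = inj₂ (suc i , s≤s p , trans q (sym e))

module Image where

  open ListIndex
  open Rotation
  open RotationPerm
  open Nesting
  open Counting
  open Statistics

  module NestPermutation (n : ℕ) (ps : List (ℕ × ℕ)) (N : Nest 1 n ps) where

    σ : List ℕ
    σ = applyRots ps (range1 n)

    length-σ : length σ ≡ n
    length-σ = trans (length-applyRots ps (range1 n)) (length-range1 n)

    intervals : Intervals (length (range1 n)) ps
    intervals = subst (λ m → Intervals m ps) (sym (length-range1 n)) (Nest-intervals 1 n ps N)

    σ-at : ∀ i → i < n → at σ (suc i) ≡ R ps (suc i)
    σ-at i p with R-range 1 n ps N (suc i) (s≤s z≤n) p
    ... | (_ , v) with R ps (suc i) in e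
    ...   | suc k =
      trans (applyRots-at ps (range1 n) (All.map (λ (u , _ , w) → u , w) intervals) (suc i))
            (trans (cong (at (range1 n)) e) (at-range1 n k v))

    σ-at′ : ∀ p → 1 ≤ p → p ≤ n → at σ p ≡ R ps p
    σ-at′ (suc i) _ q = σ-at i q

    isPerm : IsPerm n σ
    isPerm = applyRots↭ ps (range1 n) intervals

    avoids : Avoids231 σ
    avoids a b c a1 ab bc cl (x , y) =
      R-avoids231 1 n ps N a b c ab bc
        (subst₂ _<_ (σ-at′ c c1 cn) (σ-at′ a a1 an) x)
        (subst₂ _<_ (σ-at′ a a1 an) (σ-at′ b b1 bn) y)
      where
      cn : c ≤ n
      cn = subst (c ≤_) length-σ cl
      b1 : 1 ≤ b
      b1 = ≤-trans a1 (<⇒≤ ab)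
      c1 : 1 ≤ c
      c1 = ≤-trans b1 (<⇒≤ bc)
      bn : b ≤ n
      bn = ≤-trans (<⇒≤ bc) cn
      an : a ≤ n
      an = ≤-trans (<⇒≤ ab) bn

    isDescent≡member : ∀ i → i < n ∸ 1 → isDescent σ (suc i) ≡ suc i ∈ᵇ As ps
    isDescent≡member i p = bool-iff
      (λ e → ∈⇒∈ᵇ (suc i) (As ps) (descent⇒left-endpoint 1 n ps N (suc i)
                (subst₂ _<_ (σ-at (suc i) i+1<n) (σ-at i i<n) (<?-sound _ _ e))))
      (λ e → dec-true (_ <? _) (subst₂ _<_ (sym (σ-at (suc i) i+1<n)) (sym (σ-at i i<n))
                (left-endpoint⇒descent 1 n ps N (suc i) (∈ᵇ⇒∈ (suc i) (As ps) e))))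
      where
      i+1<n : suc i < n
      i+1<n = <∸1⇒suc< i n p
      i<n : i < n
      i<n = <-trans (n<1+n i) i+1<n

    des-σ : des σ ≡ length ps
    des-σ = begin
      des σ                              ≡⟨ des≡cnt σ ⟩
      cnt (isDescent σ) (length σ ∸ 1)   ≡⟨ cong (λ m → cnt (isDescent σ) (m ∸ 1)) length-σ ⟩
      cnt (isDescent σ) (n ∸ 1)          ≡⟨ cnt-ext _ _ (n ∸ 1) isDescent≡member ⟩
      cnt (λ i → i ∈ᵇ As ps) (n ∸ 1)     ≡⟨ cnt-members (As ps) (n ∸ 1) (Nest-As-sorted 1 n ps N) endpoints-range ⟩
      length (As ps)                     ≡⟨ length-map proj₁ ps ⟩
      length ps                          ∎
      where
      open ≡-Reasoning
      endpoints-range : All (λ x → 1 ≤ x × x ≤ n ∸ 1) (As ps)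
      endpoints-range = All.map (λ (u , v) → u , <⇒≤∸1 _ n v) (Nest-As 1 n ps N)

    maxdrop-σ : maxdrop σ ≡ length ps
    maxdrop-σ = ≤-antisym upper lower
      where
      drop-at : ∀ i → i < n → at (drops σ) (suc i) ≡ suc i ∸ R ps (suc i)
      drop-at i il = trans (at-drops σ i (subst (i <_) (sym length-σ) il)) (cong (suc i ∸_) (σ-at i il))
      upper : maxdrop σ ≤ length ps
      upper = max-least (drops σ) (length ps) λ i p →
        let il = subst (i <_) (trans (length-drops σ) length-σ) p in
        subst (_≤ length ps) (sym (drop-at i il)) (R-drop≤length 1 n ps N (suc i))
      lower : length ps ≤ maxdrop σ
      lower with R-drop-attained n ps N
      ... | inj₁ e = subst (_≤ maxdrop σ) (sym e) z≤n
      ... | inj₂ (i , il , e) =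
        subst (_≤ maxdrop σ) (trans (drop-at i il) e)
              (max-upper (drops σ) i (subst (i <_) (sym (trans (length-drops σ) length-σ)) il))

  image-injective : ∀ n ps qs → Nest 1 n ps → Nest 1 n qs →
    applyRots ps (range1 n) ≡ applyRots qs (range1 n) → ps ≡ qs
  image-injective n ps qs Np Nq e = R-injective 1 n ps qs Np Nq same-R
    where
    module Ip = NestPermutation n ps Np
    module Iq = NestPermutation n qs Nq
    same-R : ∀ i → R ps i ≡ R qs i
    same-R zero = trans (R-below 1 n ps Np 0 (s≤s z≤n)) (sym (R-below 1 n qs Nq 0 (s≤s z≤n)))
    same-R (suc i) with i <? n
    ... | yes p = trans (sym (Ip.σ-at i p)) (trans (cong (λ τ → at τ (suc i)) e) (Iq.σ-at i p))
    ... | no p  = trans (R-above 1 n ps Np (suc i) (s≤s (≮⇒≥ p))) (sym (R-above 1 n qs Nq (suc i) (s≤s (≮⇒≥ p))))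

module Chain where

  T⇒≡true : ∀ {b} → T b → b ≡ true
  T⇒≡true {true} _ = refl

  MaxBelow : ℕ → List ℕ → ℕ → Set
  MaxBelow k S x = x ∈ S × x ≤ k × (∀ y → y ∈ S → y ≤ k → y ≤ x)

  maxBelow-spec : ∀ k xs →
    (maxBelow k xs ≡ nothing × (∀ y → y ∈ xs → k < y)) ⊎ (Σ ℕ λ x → maxBelow k xs ≡ just x × MaxBelow k xs x)
  maxBelow-spec k [] = inj₁ (refl , λ y ())
  maxBelow-spec k (x ∷ xs) with x ≤ᵇ k in e | maxBelow k xs | maxBelow-spec k xs
  ... | true | nothing | inj₁ (_ , f) = inj₂ (x , refl , here refl , xk , largest)
    where
    xk : x ≤ k
    xk = ≤ᵇ⇒≤ x k (subst T (sym e) tt)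
    largest : ∀ y → y ∈ x ∷ xs → y ≤ k → y ≤ x
    largest y (here refl) _  = ≤-refl
    largest y (there m)   yk = ⊥-elim (<⇒≱ (f y m) yk)
  ... | true | just m | inj₂ (m′ , refl , (mi , mk , mf)) = inj₂ (x ⊔ m , refl , member , ⊔-lub xk mk , largest)
    where
    xk : x ≤ k
    xk = ≤ᵇ⇒≤ x k (subst T (sym e) tt)
    member : x ⊔ m ∈ x ∷ xs
    member with ⊔-sel x m
    ... | inj₁ p rewrite p = here refl
    ... | inj₂ p rewrite p = there mi
    largest : ∀ y → y ∈ x ∷ xs → y ≤ k → y ≤ x ⊔ m
    largest y (here refl) _  = m≤m⊔n x m
    largest y (there q)   yk = ≤-trans (mf y q yk) (m≤n⊔m x m)
  ... | false | r | inj₁ (p , f) = inj₁ (p , above)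
    where
    xk : ¬ x ≤ k
    xk q with trans (sym e) (T⇒≡true (≤⇒≤ᵇ q))
    ... | ()
    above : ∀ y → y ∈ x ∷ xs → k < y
    above y (here refl) = ≰⇒> xk
    above y (there q)   = f y q
  ... | false | r | inj₂ (m , p , (mi , mk , mf)) = inj₂ (m , p , there mi , mk , largest)
    where
    xk : ¬ x ≤ k
    xk q with trans (sym e) (T⇒≡true (≤⇒≤ᵇ q))
    ... | ()
    largest : ∀ y → y ∈ x ∷ xs → y ≤ k → y ≤ m
    largest y (here refl) yk = ⊥-elim (xk yk)
    largest y (there q)   yk = mf y q yk
  ... | true | nothing | inj₂ (_ , () , _)
  ... | true | just _  | inj₁ (() , _)

  MaxBelow-unique : ∀ {k S x x′} → MaxBelow k S x → MaxBelow k S x′ → x ≡ x′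
  MaxBelow-unique (xi , xk , f) (xi′ , xk′ , f′) = ≤-antisym (f′ _ xi xk) (f _ xi′ xk′)

  maxBelow-just : ∀ {k S x} → MaxBelow k S x → maxBelow k S ≡ just x
  maxBelow-just {k} {S} {x} M@(xi , xk , _) with maxBelow-spec k S
  ... | inj₁ (_ , f) = ⊥-elim (<⇒≱ (f x xi) xk)
  ... | inj₂ (x′ , e , M′) rewrite MaxBelow-unique M M′ = e

  module ChainSpec (n : ℕ) (S : List ℕ) where

    StepOK : ℕ → ℕ → ℕ → Set
    StepOK m prev b = ((n + m ∸ 1) ∈ᵇ S ≡ true × b ≡ prev)
                    ⊎ ((n + m ∸ 1) ∈ᵇ S ≡ false × MaxBelow (prev ∸ 1) S b)

    ChainOK : ℕ → ℕ → List ℕ → Set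
    ChainOK prev m []       = ⊤
    ChainOK prev m (b ∷ bs) = StepOK m prev b × ChainOK b (suc m) bs

    chain-just : ∀ prev m bs → ChainOK prev m bs → bRest n S prev m (length bs) ≡ just bs
    chain-just prev m []       _                       = refl
    chain-just prev m (b ∷ bs) (inj₁ (e , refl) , C)   rewrite e | chain-just prev (suc m) bs C = refl
    chain-just prev m (b ∷ bs) (inj₂ (e , M) , C)      rewrite e | maxBelow-just M | chain-just b (suc m) bs C = refl

    bSeq-just : ∀ b₁ bs → MaxBelow n S b₁ → ChainOK b₁ 2 bs → bSeq n (suc (length bs)) S ≡ just (b₁ ∷ bs)
    bSeq-just b₁ bs M C rewrite maxBelow-just M | chain-just b₁ 2 bs C = refl

module Decode where

  open Counting
  open Chain
  open Nesting

  sorted-ext : ∀ xs ys → AllPairs _<_ xs → AllPairs _<_ ys →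
    (∀ x → x ∈ xs → x ∈ ys) → (∀ x → x ∈ ys → x ∈ xs) → xs ≡ ys
  sorted-ext []       []       _         _         f g = refl
  sorted-ext []       (y ∷ ys) _         _         f g with g y (here refl)
  ... | ()
  sorted-ext (x ∷ xs) []       _         _         f g with f x (here refl)
  ... | ()
  sorted-ext (x ∷ xs) (y ∷ ys) (hx ∷ px) (hy ∷ py) f g with ≤-antisym (head≤ hx (g y (here refl))) (head≤ hy (f x (here refl)))
    where
    head≤ : ∀ {x y zs} → All (x <_) zs → y ∈ x ∷ zs → x ≤ y
    head≤ h (here refl) = ≤-refl
    head≤ h (there m)   = <⇒≤ (All.lookup h m)
  ... | refl = cong (x ∷_) (sorted-ext xs ys px py (tail f hx) (tail g hy))
    where
    tail : ∀ {us vs} → (∀ z → z ∈ x ∷ us → z ∈ x ∷ vs) → All (x <_) us → ∀ z → z ∈ us → z ∈ vs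
    tail h hu z m with h z (there m)
    ... | here refl = ⊥-elim (<-irrefl refl (All.lookup hu m))
    ... | there m′  = m′

  take-⊆ : ∀ k (zs : List ℕ) {z} → z ∈ take k zs → z ∈ zs
  take-⊆ (suc k) (z ∷ zs) (here e)  = here e
  take-⊆ (suc k) (z ∷ zs) (there q) = there (take-⊆ k zs q)

  pivot : ∀ xs j → AllPairs _<_ xs → 1 ≤ j → j ≤ length xs →
    at xs j ∈ take j xs × (∀ y → y ∈ take j xs → y ≤ at xs j) × (∀ y → y ∈ drop j xs → at xs j < y)
  pivot (x ∷ xs) (suc zero)    (h ∷ p) _ _ = here refl , (λ { y (here refl) → ≤-refl }) , (λ y m → All.lookup h m)
  pivot (x ∷ xs) (suc (suc j)) (h ∷ p) _ (s≤s jl) with pivot xs (suc j) p (s≤s z≤n) jl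
  ... | (m , f , g) = there m , f′ , g
    where
    f′ : ∀ y → y ∈ x ∷ take (suc j) xs → y ≤ at xs (suc j)
    f′ y (here refl) = <⇒≤ (All.lookup h (take-⊆ (suc j) xs m))
    f′ y (there q)   = f y q

  -- Indices m at which the sequence b stays (b_m = b_{m-1}); such an m is recorded
  -- in S by the element n + m - 1 > n.
  StayFrom : ℕ → ℕ → ℕ → List ℕ → ℕ → Set
  StayFrom n prev m []       x = ⊥
  StayFrom n prev m (b ∷ bs) x = (x ≡ n + m ∸ 1 × b ≡ prev) ⊎ StayFrom n b (suc m) bs x

  Stay : ℕ → List ℕ → ℕ → Set
  Stay n []       x = ⊥
  Stay n (b ∷ bs) x = StayFrom n b 2 bs x

  Recovered : ℕ → List ℕ → List ℕ → ℕ → Set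
  Recovered n A bs x = x ∈ A ⊎ x ∈ bs ⊎ Stay n bs x

  lastOf : ℕ → List ℕ → ℕ
  lastOf p []       = p
  lastOf p (b ∷ bs) = lastOf b bs

  module ChainFacts (n : ℕ) (S : List ℕ) (S1 : All (1 ≤_) S) where
    open ChainSpec n S

    chain-members : ∀ prev m bs → prev ∈ S → ChainOK prev m bs → All (_∈ S) bs
    chain-members prev m []       _ _ = []
    chain-members prev m (b ∷ bs) p (inj₁ (_ , refl) , C)          = p ∷ chain-members b (suc m) bs p C
    chain-members prev m (b ∷ bs) p (inj₂ (_ , (bm , _ , _)) , C)  = bm ∷ chain-members b (suc m) bs bm C

    chain-decr : ∀ prev m bs → ChainOK prev m bs → Decr prev bs
    chain-decr prev m []       _ = tt
    chain-decr prev m (b ∷ bs) (inj₁ (_ , refl) , C)         = ≤-refl , chain-decr b (suc m) bs C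
    chain-decr prev m (b ∷ bs) (inj₂ (_ , (_ , bp , _)) , C) = ≤-trans bp (m∸n≤m prev 1) , chain-decr b (suc m) bs C

    step-largest : ∀ m prev b z → StepOK m prev b → z ∈ S → z < prev → z ≤ b
    step-largest m prev b z (inj₁ (_ , refl))        zS zlt = <⇒≤ zlt
    step-largest m prev b z (inj₂ (_ , (_ , _ , mx))) zS zlt = mx z zS (<⇒≤∸1 z prev zlt)

    chain-covers : ∀ prev m bs → ChainOK prev m bs → ∀ z → z ∈ S → lastOf prev bs ≤ z → z ≤ prev → z ∈ prev ∷ bs
    chain-covers prev m []       C        z zS lz zp = here (≤-antisym zp lz)
    chain-covers prev m (b ∷ bs) (st , C) z zS lz zp with z ≟ prev
    ... | yes e = here e
    ... | no ne = there (chain-covers b (suc m) bs C z zS lz (step-largest m prev b z st zS (≤∧≢⇒< zp ne)))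

    stay-member : ∀ prev m bs x → prev ∈ S → ChainOK prev m bs → StayFrom n prev m bs x → x ∈ S
    stay-member prev m (b ∷ bs) x p (inj₁ (e , _) , C)            (inj₁ (refl , _)) = ∈ᵇ⇒∈ _ S e
    stay-member prev m (b ∷ bs) x p (inj₂ (e , (_ , bp , _)) , C) (inj₁ (refl , refl)) =
      ⊥-elim (<-irrefl refl (≤-<-trans bp (∸1< prev (All.lookup S1 p))))
    stay-member prev m (b ∷ bs) x p (inj₁ (_ , refl) , C)         (inj₂ s) = stay-member b (suc m) bs x p C s
    stay-member prev m (b ∷ bs) x p (inj₂ (_ , (bm , _ , _)) , C) (inj₂ s) = stay-member b (suc m) bs x bm C s

    member-stay : ∀ prev m y bs x → ChainOK prev m bs → n + m ∸ 1 ≡ suc y → y < x → x ≤ y + length bs →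
      x ∈ S → StayFrom n prev m bs x
    member-stay prev m y []       x C        e yx xl xS = ⊥-elim (<⇒≱ yx (subst (x ≤_) (+-identityʳ y) xl))
    member-stay prev m y (b ∷ bs) x (st , C) e yx xl xS with x ≟ suc y
    ... | yes refl with st
    ...   | inj₁ (_ , bp) = inj₁ (sym e , bp)
    ...   | inj₂ (f , _) with trans (sym f) (trans (cong (_∈ᵇ S) e) (∈⇒∈ᵇ _ S xS))
    ...     | ()
    member-stay prev m y (b ∷ bs) x (st , C) e yx xl xS | no ne =
      inj₂ (member-stay b (suc m) (suc y) bs x C (next-index n m y e) (≤∧≢⇒< yx (λ q → ne (sym q)))
                        (subst (x ≤_) (+-suc y (length bs)) xl) xS)

  -- The argument counts elements of S: with C x = |S ∩ [1,x]| we have C a_j = j and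
  -- C(n+j-1) = 2j.  Each index m with n+m-1 ∉ S is a "drop" step of the chain, which
  -- moves b to the previous element of S and lowers C b by one; counting shows that
  -- C b₁ = j + 1 + (number of drops), so the chain never descends to a_j or below.
  module Decoding (n j : ℕ) (S : List ℕ) (sub : IsSubset n j S) (n1 : 1 ≤ n) (j1 : 1 ≤ j) where
    open ChainSpec n S

    S-bounds : All (λ x → 1 ≤ x × x ≤ n + j ∸ 1) S
    S-bounds = proj₁ (proj₂ sub)

    S1 : All (1 ≤_) S
    S1 = All.map proj₁ S-bounds

    open ChainFacts n S S1

    S-sorted : AllPairs _<_ S
    S-sorted = Linked⇒AllPairs <-trans (proj₁ sub)

    A : List ℕ
    A = take j S

    j≤|S| : j ≤ length S
    j≤|S| = subst (j ≤_) (sym (proj₂ (proj₂ sub))) (m≤m+n j (j + 0))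

    length-A : length A ≡ j
    length-A = trans (length-take j S) (m≤n⇒m⊓n≡m j≤|S|)

    aj : ℕ
    aj = at S j

    A⊆S : ∀ {y} → y ∈ A → y ∈ S
    A⊆S m = take-⊆ j S m

    aj∈S : aj ∈ S
    aj∈S = A⊆S (proj₁ (pivot S j S-sorted j1 j≤|S|))

    A≤aj : ∀ y → y ∈ A → y ≤ aj
    A≤aj = proj₁ (proj₂ (pivot S j S-sorted j1 j≤|S|))

    A-bounds : All (λ a → 1 ≤ a × a ≤ aj) A
    A-bounds = All.tabulate (λ {x} m → All.lookup S1 (A⊆S m) , A≤aj x m)

    ≤aj⇒∈A : ∀ y → y ∈ S → y ≤ aj → y ∈ A
    ≤aj⇒∈A y m le with ∈-++⁻ A (subst (y ∈_) (sym (take++drop≡id j S)) m)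
    ... | inj₁ p = p
    ... | inj₂ p = ⊥-elim (<⇒≱ (proj₂ (proj₂ (pivot S j S-sorted j1 j≤|S|)) y p) le)

    C : ℕ → ℕ
    C = cnt (λ z → z ∈ᵇ S)

    C-aj : C aj ≡ j
    C-aj = trans (cnt-ext _ _ aj same) (trans (cnt-members A aj (AllPairsP.take⁺ j S-sorted) A-bounds) length-A)
      where
      same : ∀ i → i < aj → suc i ∈ᵇ S ≡ suc i ∈ᵇ A
      same i p = bool-iff (λ e → ∈⇒∈ᵇ _ A (≤aj⇒∈A (suc i) (∈ᵇ⇒∈ _ S e) p))
                          (λ e → ∈⇒∈ᵇ _ S (A⊆S (∈ᵇ⇒∈ _ A e)))

    C-top : C (n + j ∸ 1) ≡ 2 * j
    C-top = trans (cnt-members S (n + j ∸ 1) S-sorted S-bounds) (proj₂ (proj₂ sub))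

    C-hit : ∀ z → z ∈ S → C z ≡ suc (C (z ∸ 1))
    C-hit (suc z) m = cnt-hit _ z (∈⇒∈ᵇ _ S m)
    C-hit zero    m = ⊥-elim (<-irrefl refl (All.lookup S1 m))

    C-gap : ∀ b x → x ∈ S → b < x → (∀ z → z ∈ S → z < x → z ≤ b) → C x ≡ suc (C b)
    C-gap b (suc x) xS bx mx = trans (C-hit (suc x) xS)
      (cong suc (cnt-gap _ b x (≤-pred bx) (λ i u v → ∉⇒∈ᵇ i S (λ iS → <⇒≱ u (mx i iS (s≤s v))))))

    C-two-above : ∀ z p → z ∈ S → aj < z → z < p → p ∈ S → suc (suc (C aj)) ≤ C p
    C-two-above z p zS az zp pS =
      ≤-trans (s≤s (≤-trans (s≤s (cnt-mono _ aj (z ∸ 1) (<⇒≤∸1 aj z az))) (≤-reflexive (sym (C-hit z zS)))))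
              (≤-trans (s≤s (cnt-mono _ z (p ∸ 1) (<⇒≤∸1 z p zp))) (≤-reflexive (sym (C-hit p pS))))

    drops : ℕ → ℕ → ℕ
    drops y zero    = 0
    drops y (suc k) = ind (not (suc y ∈ᵇ S)) + drops (suc y) k

    stays : ℕ → ℕ → ℕ
    stays y zero    = 0
    stays y (suc k) = ind (suc y ∈ᵇ S) + stays (suc y) k

    drops+stays : ∀ y k → drops y k + stays y k ≡ k
    drops+stays y zero = refl
    drops+stays y (suc k) with suc y ∈ᵇ S
    ... | true  = trans (+-suc (drops (suc y) k) (stays (suc y) k)) (cong suc (drops+stays (suc y) k))
    ... | false = cong suc (drops+stays (suc y) k)

    C+stays : ∀ y k → C y + stays y k ≡ C (y + k)
    C+stays y zero    = trans (+-identityʳ (C y)) (cong C (sym (+-identityʳ y)))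
    C+stays y (suc k) = trans (sym (+-assoc (C y) _ _)) (trans (C+stays (suc y) k) (cong C (sym (+-suc y k))))

    predecessor : ∀ prev → prev ∈ S → aj < prev →
      Σ ℕ λ b → MaxBelow (prev ∸ 1) S b × C prev ≡ suc (C b)
    predecessor prev pS ap with maxBelow-spec (prev ∸ 1) S
    ... | inj₁ (_ , f) = ⊥-elim (<⇒≱ (f aj aj∈S) (<⇒≤∸1 aj prev ap))
    ... | inj₂ (b , _ , MB@(bS , bp , mx)) =
      b , MB , C-gap b prev pS (≤-<-trans bp (∸1< prev (All.lookup S1 pS))) (λ z zS zp → mx z zS (<⇒≤∸1 z prev zp))

    above-aj : ∀ b x d → MaxBelow x S b → aj ≤ x → C b ≡ C aj + suc d → aj < b
    above-aj b x d (_ , _ , mx) ajx cb with <-cmp aj b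
    ... | tri< p _ _ = p
    ... | tri≈ _ p _ = ⊥-elim (<-irrefl refl (subst (C aj <_) (sym (trans (cong C p) cb)) (m<m+n (C aj) (s≤s z≤n))))
    ... | tri> _ _ p = ⊥-elim (<⇒≱ p (mx aj aj∈S ajx))

    invariant-step : ∀ p b d → C p ≡ suc (C b) → C p ≡ C aj + suc (suc d) → C b ≡ C aj + suc d
    invariant-step p b d gap ce = suc-injective (trans (sym gap) (trans ce (+-suc (C aj) (suc d))))

    build-chain : ∀ k m y prev → n + m ∸ 1 ≡ suc y → prev ∈ S → aj < prev → C prev ≡ C aj + suc (drops y k) →
      Σ (List ℕ) λ bs → ChainOK prev m bs × length bs ≡ k × All (aj <_) bs ×
                        (∀ z → z ∈ S → aj < z → lastOf prev bs ≤ z)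
    build-chain zero m y prev e pS ap ce = [] , tt , refl , [] , least
      where
      least : ∀ z → z ∈ S → aj < z → prev ≤ z
      least z zS az with prev ≤? z
      ... | yes q = q
      ... | no q = ⊥-elim (<⇒≱ (subst (suc (suc (C aj)) ≤_) ce (C-two-above z prev zS az (≰⇒> q) pS))
                               (≤-reflexive (trans (+-suc (C aj) 0) (cong suc (+-identityʳ (C aj))))))
    build-chain (suc k) m y prev e pS ap ce with suc y ∈ᵇ S in member
    ... | true with build-chain k (suc m) (suc y) prev (next-index n m y e) pS ap ce
    ...   | (bs , ok , l , above , least) =
      prev ∷ bs , (inj₁ (trans (cong (_∈ᵇ S) e) member , refl) , ok) , cong suc l , ap ∷ above , least
    build-chain (suc k) m y prev e pS ap ce | false with predecessor prev pS ap
    ... | (b , MB , gap) with invariant-step prev b (drops (suc y) k) gap ce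
    ... | cb with above-aj b (prev ∸ 1) (drops (suc y) k) MB (<⇒≤∸1 aj prev ap) cb
    ... | ajb with build-chain k (suc m) (suc y) b (next-index n m y e) (proj₁ MB) ajb cb
    ... | (bs , ok , l , above , least) =
      b ∷ bs , (inj₂ (trans (cong (_∈ᵇ S) e) member , MB) , ok) , cong suc l , ajb ∷ above , least

    j′ : ℕ
    j′ = j ∸ 1

    top-index : n + j′ ≡ n + j ∸ 1
    top-index = trans (sym (cong (_∸ 1) (+-suc n j′))) (cong (λ t → n + t ∸ 1) (suc∸1 j j1))

    -- C n = C a_j + 1 + (number of drops among n+1, …, n+j-1), since the top part
    -- of S consists of the j - 1 - drops stays and C(n + j - 1) = 2j.
    C-n : C n ≡ C aj + suc (drops n j′)
    C-n = +-cancelʳ-≡ (stays n j′) (C n) (C aj + suc (drops n j′)) (trans by-top (sym by-aj))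
      where
      by-top : C n + stays n j′ ≡ 2 * j
      by-top = trans (C+stays n j′) (trans (cong C top-index) C-top)
      by-aj : C aj + suc (drops n j′) + stays n j′ ≡ 2 * j
      by-aj = trans (+-assoc (C aj) (suc (drops n j′)) (stays n j′))
                (trans (cong (λ t → C aj + suc t) (drops+stays n j′))
                (trans (cong₂ _+_ C-aj (suc∸1 j j1)) (cong (j +_) (sym (+-identityʳ j)))))

    aj<n : aj < n
    aj<n with aj <? n
    ... | yes p = p
    ... | no p = ⊥-elim (<⇒≱ (m<m+n (C aj) (s≤s z≤n)) (subst (_≤ C aj) C-n (cnt-mono _ n aj (≮⇒≥ p))))

    first-b : Σ ℕ λ b₁ → MaxBelow n S b₁ × aj < b₁ × C b₁ ≡ C aj + suc (drops n j′)
    first-b with maxBelow-spec n S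
    ... | inj₁ (_ , f) = ⊥-elim (<-asym (f aj aj∈S) aj<n)
    ... | inj₂ (b₁ , _ , MB@(_ , b₁n , mx)) = b₁ , MB , above-aj b₁ n _ MB (<⇒≤ aj<n) Cb₁ , Cb₁
      where
      Cb₁ : C b₁ ≡ C aj + suc (drops n j′)
      Cb₁ = trans (sym (cnt-gap _ b₁ n b₁n (λ i u v → ∉⇒∈ᵇ i S (λ iS → <⇒≱ u (mx i iS v))))) C-n

    b₁ : ℕ
    b₁ = proj₁ first-b

    b₁-max : MaxBelow n S b₁
    b₁-max = proj₁ (proj₂ first-b)

    aj<b₁ : aj < b₁
    aj<b₁ = proj₁ (proj₂ (proj₂ first-b))

    chain : Σ (List ℕ) λ bs → ChainOK b₁ 2 bs × length bs ≡ j′ × All (aj <_) bs ×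
                              (∀ z → z ∈ S → aj < z → lastOf b₁ bs ≤ z)
    chain = build-chain j′ 2 n b₁ (n+2∸1 n) (proj₁ b₁-max) aj<b₁ (proj₂ (proj₂ (proj₂ first-b)))

    rest : List ℕ
    rest = proj₁ chain

    rest-ok : ChainOK b₁ 2 rest
    rest-ok = proj₁ (proj₂ chain)

    length-rest : length rest ≡ j′
    length-rest = proj₁ (proj₂ (proj₂ chain))

    rest-above : All (aj <_) rest
    rest-above = proj₁ (proj₂ (proj₂ (proj₂ chain)))

    rest-least : ∀ z → z ∈ S → aj < z → lastOf b₁ rest ≤ z
    rest-least = proj₂ (proj₂ (proj₂ (proj₂ chain)))

    bs : List ℕ
    bs = b₁ ∷ rest

    length-bs : length bs ≡ j
    length-bs = trans (cong suc length-rest) (suc∸1 j j1)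

    bSeq-bs : bSeq n j S ≡ just bs
    bSeq-bs = subst (λ t → bSeq n t S ≡ just bs) length-bs (bSeq-just b₁ rest b₁-max rest-ok)

    nest : Nest 1 n (zip A bs)
    nest = zip-Nest 1 n aj A bs (AllPairsP.take⁺ j S-sorted) A-bounds (aj<b₁ ∷ rest-above)
             (proj₁ (proj₂ b₁-max) , chain-decr b₁ 2 rest rest-ok) (trans length-A (sym length-bs))

    -- Every element of S is a left endpoint (≤ a_j), a b (in (a_j, n]) or a stay (> n) ...
    recover : ∀ x → x ∈ S → Recovered n A bs x
    recover x xS with x ≤? aj | x ≤? n
    ... | yes p | _    = inj₁ (≤aj⇒∈A x xS p)
    ... | no p  | yes q =
      inj₂ (inj₁ (chain-covers b₁ 2 rest rest-ok x xS (rest-least x xS (≰⇒> p)) (proj₂ (proj₂ b₁-max) x xS q)))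
    ... | no p  | no q  = inj₂ (inj₂ (member-stay b₁ 2 n rest x rest-ok (n+2∸1 n) (≰⇒> q) x≤top xS))
      where
      x≤top : x ≤ n + length rest
      x≤top = subst (x ≤_) (trans (sym top-index) (cong (n +_) (sym length-rest))) (proj₂ (All.lookup S-bounds xS))

    recovered : ∀ x → Recovered n A bs x → x ∈ S
    recovered x (inj₁ m)                  = A⊆S m
    recovered x (inj₂ (inj₁ (here refl))) = proj₁ b₁-max
    recovered x (inj₂ (inj₁ (there m)))   = All.lookup (chain-members b₁ 2 rest (proj₁ b₁-max) rest-ok) m
    recovered x (inj₂ (inj₂ st))          = stay-member b₁ 2 rest x (proj₁ b₁-max) rest-ok st

  decoding-injective : ∀ n j S T → 1 ≤ n → 1 ≤ j → IsSubset n j S → IsSubset n j T →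
    take j S ≡ take j T → bSeq n j S ≡ bSeq n j T → S ≡ T
  decoding-injective n j S T n1 j1 sS sT eA eB =
    sorted-ext S T DS.S-sorted DT.S-sorted
      (λ x m → DT.recovered x (subst₂ (λ A bs → Recovered n A bs x) eA eb (DS.recover x m)))
      (λ x m → DS.recovered x (subst₂ (λ A bs → Recovered n A bs x) (sym eA) (sym eb) (DT.recover x m)))
    where
    module DS = Decoding n j S sS n1 j1
    module DT = Decoding n j T sT n1 j1
    eb : DS.bs ≡ DT.bs
    eb = just-injective (trans (sym DS.bSeq-bs) (trans eB DT.bSeq-bs))

module Encode where

  open Counting
  open Chain
  open Nesting

  stayᵇ : ℕ → ℕ → ℕ → List ℕ → ℕ → Bool
  stayᵇ n prev m []       x = false
  stayᵇ n prev m (b ∷ bs) x = (does (x ≟ (n + m ∸ 1)) ∧ does (b ≟ prev)) ∨ stayᵇ n b (suc m) bs x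

  stay-range : ∀ n prev m y bs x → n + m ∸ 1 ≡ suc y → stayᵇ n prev m bs x ≡ true →
    suc y ≤ x × x ≤ y + length bs
  stay-range n prev m y (b ∷ bs) x e s with ∨-true (does (x ≟ (n + m ∸ 1)) ∧ does (b ≟ prev)) _ s
  ... | inj₁ t with ≟-sound x _ (proj₁ (∧-true _ _ t))
  ...   | refl = ≤-reflexive (sym e) ,
                 subst (_≤ y + suc (length bs)) (sym e) (subst (suc y ≤_) (sym (+-suc y _)) (s≤s (m≤m+n y _)))
  stay-range n prev m y (b ∷ bs) x e s | inj₂ r with stay-range n b (suc m) (suc y) bs x (next-index n m y e) r
  ... | (u , v) = <⇒≤ u , subst (x ≤_) (sym (+-suc y _)) v

  bDrops : ℕ → List ℕ → ℕ
  bDrops prev []       = 0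
  bDrops prev (b ∷ bs) = ind (not (does (b ≟ prev))) + bDrops b bs

  bStays : ℕ → List ℕ → ℕ
  bStays prev []       = 0
  bStays prev (b ∷ bs) = ind (does (b ≟ prev)) + bStays b bs

  bDrops+bStays : ∀ prev bs → bDrops prev bs + bStays prev bs ≡ length bs
  bDrops+bStays prev []       = refl
  bDrops+bStays prev (b ∷ bs) with does (b ≟ prev)
  ... | true  = trans (+-suc (bDrops b bs) (bStays b bs)) (cong suc (bDrops+bStays b bs))
  ... | false = cong suc (bDrops+bStays b bs)

  count-bs : ∀ K prev bs → Decr prev bs → All (λ b → 1 ≤ b × b ≤ K) (prev ∷ bs) →
    cnt (λ x → x ∈ᵇ (prev ∷ bs)) K ≡ suc (bDrops prev bs)
  count-bs K prev [] _ ((p1 , pK) ∷ []) =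
    trans (cnt-∨ (λ x → does (x ≟ prev)) (λ _ → false) K (λ _ _ → refl))
          (cong₂ _+_ (cnt-single prev K p1 pK) (cnt-none (λ _ → false) K (λ _ _ → refl)))
  count-bs K prev (b ∷ bs) (bp , D) ((p1 , pK) ∷ bnd@(_ ∷ _)) with b ≟ prev
  ... | yes refl =
    trans (cnt-ext _ _ K (λ i _ → ∨-idem (does (suc i ≟ b)) _))
          (trans (count-bs K b bs D bnd) (cong suc (sym (cong (λ t → ind (not t) + bDrops b bs) (dec-true (b ≟ b) refl)))))
    where
    ∨-idem : ∀ a r → a ∨ (a ∨ r) ≡ a ∨ r
    ∨-idem true  r = refl
    ∨-idem false r = refl
  ... | no ne =
    trans (cnt-∨ (λ x → does (x ≟ prev)) (λ x → x ∈ᵇ (b ∷ bs)) K disjoint)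
          (trans (cong₂ _+_ (cnt-single prev K p1 pK) (count-bs K b bs D bnd))
                 (cong suc (sym (cong (λ t → ind (not t) + bDrops b bs) (dec-false (b ≟ prev) ne)))))
    where
    disjoint : ∀ x → does (x ≟ prev) ≡ true → x ∈ᵇ (b ∷ bs) ≡ false
    disjoint x e with ≟-sound x prev e
    ... | refl = ∉⇒∈ᵇ x (b ∷ bs)
                   (λ m → <-irrefl refl (≤-<-trans (All.lookup (Decr-bounded b (b ∷ bs) (≤-refl , D)) m) (≤∧≢⇒< bp ne)))

  count-stays : ∀ n K prev m y bs → n + m ∸ 1 ≡ suc y → y + length bs ≤ K →
    cnt (stayᵇ n prev m bs) K ≡ bStays prev bs
  count-stays n K prev m y []       e le = cnt-none _ K (λ _ _ → refl)
  count-stays n K prev m y (b ∷ bs) e le =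
    trans (cnt-∨ (λ x → does (x ≟ (n + m ∸ 1)) ∧ does (b ≟ prev)) (stayᵇ n b (suc m) bs) K disjoint)
          (cong₂ _+_ (single (does (b ≟ prev)))
                     (count-stays n K b (suc m) (suc y) bs (next-index n m y e) (subst (_≤ K) (+-suc y (length bs)) le)))
    where
    v1 : 1 ≤ n + m ∸ 1
    v1 = subst (1 ≤_) (sym e) (s≤s z≤n)
    vK : n + m ∸ 1 ≤ K
    vK = subst (_≤ K) (sym e) (≤-trans (subst (suc y ≤_) (sym (+-suc y _)) (s≤s (m≤m+n y _))) le)
    single : ∀ c → cnt (λ x → does (x ≟ (n + m ∸ 1)) ∧ c) K ≡ ind c
    single true  = trans (cnt-ext _ _ K (λ i _ → ∧-true-right (does (suc i ≟ (n + m ∸ 1))))) (cnt-single _ K v1 vK)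
      where
      ∧-true-right : ∀ a → a ∧ true ≡ a
      ∧-true-right true  = refl
      ∧-true-right false = refl
    single false = trans (cnt-ext _ _ K (λ i _ → ∧-false-right (does (suc i ≟ (n + m ∸ 1)))))
                         (cnt-none (λ _ → false) K (λ _ _ → refl))
      where
      ∧-false-right : ∀ a → a ∧ false ≡ false
      ∧-false-right true  = refl
      ∧-false-right false = refl
    disjoint : ∀ x → does (x ≟ (n + m ∸ 1)) ∧ does (b ≟ prev) ≡ true → stayᵇ n b (suc m) bs x ≡ false
    disjoint x t with stayᵇ n b (suc m) bs x in r
    ... | false = refl
    ... | true with ≟-sound x _ (proj₁ (∧-true _ _ t))
    ...   | refl = ⊥-elim (<-irrefl refl (subst (suc (suc y) ≤_) e
                     (proj₁ (stay-range n b (suc m) (suc y) bs _ (next-index n m y e) r))))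

  take-length-++ : ∀ (xs ys : List ℕ) → take (length xs) (xs ++ ys) ≡ xs
  take-length-++ []       ys = refl
  take-length-++ (x ∷ xs) ys = cong (x ∷_) (take-length-++ xs ys)

  -- Encoding a nest (a₁,b₁) ∷ ps′ of j intervals in [1, n] as the 2j-subset
  --   S = {a₁, …, a_j} ∪ {b₁, …, b_j} ∪ {n + m - 1 : b_m = b_{m-1}}
  -- of [n + j - 1]; its decoding gives back the nest.
  module Encoding (n j : ℕ) (a₁ b₁ : ℕ) (ps′ : List (ℕ × ℕ))
                  (N : Nest 1 n ((a₁ , b₁) ∷ ps′)) (lp : suc (length ps′) ≡ j) where

    ps : List (ℕ × ℕ)
    ps = (a₁ , b₁) ∷ ps′

    A : List ℕ
    A = As ps

    B′ : List ℕ
    B′ = Bs ps′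

    B : List ℕ
    B = b₁ ∷ B′

    K : ℕ
    K = n + j ∸ 1

    isStay : ℕ → Bool
    isStay = stayᵇ n b₁ 2 B′

    upper : ℕ → Bool
    upper x = x ∈ᵇ B ∨ isStay x

    F : List ℕ
    F = select upper (rng 1 K)

    S : List ℕ
    S = A ++ F

    open ChainSpec n S

    B-bounds : All (λ b → 1 < b × b ≤ n) B
    B-bounds = Nest-Bs 1 n ps N

    B-decr : Decr n B
    B-decr = Nest-Bs-decr 1 n ps N

    A<B : ∀ a → a ∈ A → ∀ b → b ∈ B → a < b
    A<B = Nest-A<B 1 n ps N

    length-B′ : length B′ ≡ length ps′
    length-B′ = length-map proj₂ ps′

    length-A : length A ≡ j
    length-A = trans (length-map proj₁ ps) lp

    K≡ : K ≡ n + length B′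
    K≡ = trans (cong (λ t → n + t ∸ 1) (sym lp)) (trans (cong (_∸ 1) (+-suc n (length ps′))) (cong (n +_) (sym length-B′)))

    n≤K : n ≤ K
    n≤K = subst (n ≤_) (sym K≡) (m≤m+n n _)

    b₁≤n : b₁ ≤ n
    b₁≤n = proj₁ B-decr

    stay-bounds : ∀ x → isStay x ≡ true → suc n ≤ x × x ≤ K
    stay-bounds x s = let (u , v) = stay-range n b₁ 2 n B′ x (n+2∸1 n) s in u , subst (x ≤_) (sym K≡) v

    S-cases : ∀ x → x ∈ S → x ∈ A ⊎ x ∈ B ⊎ isStay x ≡ true
    S-cases x m with ∈-++⁻ A m
    ... | inj₁ p = inj₁ p
    ... | inj₂ p with ∨-true (x ∈ᵇ B) (isStay x) (proj₂ (select-∈⁻ upper (rng 1 K) p))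
    ...   | inj₁ q = inj₂ (inj₁ (∈ᵇ⇒∈ x B q))
    ...   | inj₂ q = inj₂ (inj₂ q)

    upper-∈ : ∀ x → 1 ≤ x → x ≤ K → upper x ≡ true → x ∈ S
    upper-∈ x p q e = ∈-++⁺ʳ A (select-∈⁺ upper (rng 1 K) (rng-∈⁺ 1 K x p (s≤s q)) e)

    B⊆S : ∀ {x} → x ∈ B → x ∈ S
    B⊆S {x} m = upper-∈ x (<⇒≤ (proj₁ (All.lookup B-bounds m))) (≤-trans (proj₂ (All.lookup B-bounds m)) n≤K)
                  (subst (λ t → t ∨ isStay x ≡ true) (sym (∈⇒∈ᵇ x B m)) refl)

    stay⊆S : ∀ {x} → isStay x ≡ true → x ∈ S
    stay⊆S {x} s = upper-∈ x (≤-trans (s≤s z≤n) (proj₁ (stay-bounds x s))) (proj₂ (stay-bounds x s))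
                     (subst (λ t → (x ∈ᵇ B) ∨ t ≡ true) (sym s) (∨-true-right _))

    A≤n : ∀ {a} → a ∈ A → a ≤ n
    A≤n m = ≤-trans (<⇒≤ (A<B _ m b₁ (here refl))) b₁≤n

    A<F : All (λ a → All (a <_) F) A
    A<F = All.tabulate λ {a} ma → All.tabulate λ {f} mf → below a ma f mf
      where
      below : ∀ a → a ∈ A → ∀ f → f ∈ F → a < f
      below a ma f mf with ∨-true (f ∈ᵇ B) (isStay f) (proj₂ (select-∈⁻ upper (rng 1 K) mf))
      ... | inj₁ fb = A<B a ma f (∈ᵇ⇒∈ f B fb)
      ... | inj₂ fs = ≤-<-trans (A≤n ma) (proj₁ (stay-bounds f fs))

    S-sorted : Linked _<_ S
    S-sorted = AllPairs⇒Linked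
      (AllPairsP.++⁺ (Nest-As-sorted 1 n ps N) (select-sorted upper (rng 1 K) (rng-sorted 1 K)) A<F)

    S-bounds : All (λ x → 1 ≤ x × x ≤ n + j ∸ 1) S
    S-bounds = AllP.++⁺ (All.tabulate (λ m → proj₁ (All.lookup (Nest-As 1 n ps N) m) , ≤-trans (A≤n m) n≤K))
                        (All.tabulate (λ m → let (u , v) = rng-∈⁻ 1 K (proj₁ (select-∈⁻ upper (rng 1 K) m)) in u , ≤-pred v))

    B-not-stay : ∀ x → x ∈ᵇ B ≡ true → isStay x ≡ false
    B-not-stay x e with isStay x in s
    ... | false = refl
    ... | true  = ⊥-elim (<⇒≱ (proj₁ (stay-bounds x s)) (proj₂ (All.lookup B-bounds (∈ᵇ⇒∈ x B e))))

    length-F : length F ≡ j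
    length-F = begin
      length F                                          ≡⟨ length-select-rng upper K ⟩
      cnt upper K                                       ≡⟨ cnt-∨ (λ x → x ∈ᵇ B) isStay K B-not-stay ⟩
      cnt (λ x → x ∈ᵇ B) K + cnt isStay K               ≡⟨ cong₂ _+_ (count-bs K b₁ B′ (proj₂ B-decr) B-in-[1,K])
                                                                      (count-stays n K b₁ 2 n B′ (n+2∸1 n) (≤-reflexive (sym K≡))) ⟩
      suc (bDrops b₁ B′) + bStays b₁ B′                 ≡⟨ cong suc (bDrops+bStays b₁ B′) ⟩
      suc (length B′)                                   ≡⟨ trans (cong suc length-B′) lp ⟩
      j                                                 ∎
      where
      open ≡-Reasoning
      B-in-[1,K] : All (λ b → 1 ≤ b × b ≤ K) B
      B-in-[1,K] = All.map (λ (u , v) → <⇒≤ u , ≤-trans v n≤K) B-bounds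

    isSubset : IsSubset n j S
    isSubset = S-sorted , S-bounds ,
               trans (length-++ A) (trans (cong₂ _+_ length-A length-F) (cong (j +_) (sym (+-identityʳ j))))

    take-S : take j S ≡ A
    take-S = subst (λ t → take t S ≡ A) length-A (take-length-++ A F)

    b₁-max : MaxBelow n S b₁
    b₁-max = B⊆S (here refl) , b₁≤n , largest
      where
      largest : ∀ z → z ∈ S → z ≤ n → z ≤ b₁
      largest z zS zn with S-cases z zS
      ... | inj₁ za                = <⇒≤ (A<B z za b₁ (here refl))
      ... | inj₂ (inj₁ (here refl)) = ≤-refl
      ... | inj₂ (inj₁ (there m))  = All.lookup (Decr-bounded b₁ B′ (proj₂ B-decr)) m
      ... | inj₂ (inj₂ s)          = ⊥-elim (<⇒≱ (proj₁ (stay-bounds z s)) zn)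

    index-member : ∀ prev m y b bs → n + m ∸ 1 ≡ suc y → n ≤ y →
      (∀ x → y < x → isStay x ≡ stayᵇ n prev m (b ∷ bs) x) → (n + m ∸ 1) ∈ᵇ S ≡ does (b ≟ prev)
    index-member prev m y b bs e ny st = bool-iff to from
      where
      v : ℕ
      v = n + m ∸ 1
      n<v : n < v
      n<v = subst (n <_) (sym e) (s≤s ny)
      st-v : isStay v ≡ stayᵇ n prev m (b ∷ bs) v
      st-v = st v (subst (y <_) (sym e) ≤-refl)
      to : v ∈ᵇ S ≡ true → does (b ≟ prev) ≡ true
      to q with S-cases v (∈ᵇ⇒∈ v S q)
      ... | inj₁ va = ⊥-elim (<⇒≱ n<v (A≤n va))
      ... | inj₂ (inj₁ vb) = ⊥-elim (<⇒≱ n<v (proj₂ (All.lookup B-bounds vb)))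
      ... | inj₂ (inj₂ s) with ∨-true _ _ (trans (sym st-v) s)
      ...   | inj₁ t = proj₂ (∧-true _ _ t)
      ...   | inj₂ r = ⊥-elim (<-irrefl refl (subst (suc (suc y) ≤_) e
                         (proj₁ (stay-range n b (suc m) (suc y) bs v (next-index n m y e) r))))
      from : does (b ≟ prev) ≡ true → v ∈ᵇ S ≡ true
      from d = ∈⇒∈ᵇ v S (stay⊆S (trans st-v here-stay))
        where
        here-stay : stayᵇ n prev m (b ∷ bs) v ≡ true
        here-stay rewrite dec-true (v ≟ v) refl | d = refl

    -- The b-sequence of the nest is produced by the decoding steps: a drop to b goes
    -- to the largest element of S below prev, because the elements of S there are
    -- right endpoints, and those below prev all occur from b on.
    step-ok : ∀ prev m y b bs → n + m ∸ 1 ≡ suc y → n ≤ y → prev ≤ n → prev ∈ B → b ∈ B → b ≤ prev →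
      Decr b bs → (∀ z → z ∈ B → z < prev → z ∈ b ∷ bs) →
      (∀ x → y < x → isStay x ≡ stayᵇ n prev m (b ∷ bs) x) → StepOK m prev b
    step-ok prev m y b bs e ny pn pB bB bp D later st with b ≟ prev | index-member prev m y b bs e ny st
    ... | yes be | member = inj₁ (trans member (dec-true (b ≟ prev) be) , be)
    ... | no ne  | member =
      inj₂ (trans member (dec-false (b ≟ prev) ne) , B⊆S bB , <⇒≤∸1 b prev (≤∧≢⇒< bp ne) , largest)
      where
      largest : ∀ z → z ∈ S → z ≤ prev ∸ 1 → z ≤ b
      largest z zS zp with S-cases z zS
      ... | inj₁ za = <⇒≤ (A<B z za b bB)
      ... | inj₂ (inj₁ zb) = All.lookup (Decr-bounded b (b ∷ bs) (≤-refl , D)) (later z zb z<prev)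
        where
        z<prev : z < prev
        z<prev = ≤-<-trans zp (∸1< prev (<⇒≤ (proj₁ (All.lookup B-bounds pB))))
      ... | inj₂ (inj₂ s) = ⊥-elim (<⇒≱ (proj₁ (stay-bounds z s)) (≤-trans zp (≤-trans (m∸n≤m prev 1) pn)))

    chain-ok : ∀ prev m y bs → n + m ∸ 1 ≡ suc y → n ≤ y → prev ≤ n → prev ∈ B → Decr prev bs → All (_∈ B) bs →
      (∀ z → z ∈ B → z < prev → z ∈ bs) → (∀ x → y < x → isStay x ≡ stayᵇ n prev m bs x) → ChainOK prev m bs
    chain-ok prev m y []       e ny pn pB D        aB         later st = tt
    chain-ok prev m y (b ∷ bs) e ny pn pB (bp , D) (bB ∷ aB) later st =
      step-ok prev m y b bs e ny pn pB bB bp D later st ,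
      chain-ok b (suc m) (suc y) bs (next-index n m y e) (≤-trans ny (n≤1+n y)) (≤-trans bp pn) bB D aB later′ st′
      where
      later′ : ∀ z → z ∈ B → z < b → z ∈ bs
      later′ z zB zb with later z zB (<-≤-trans zb bp)
      ... | here refl = ⊥-elim (<-irrefl refl zb)
      ... | there m′  = m′
      st′ : ∀ x → suc y < x → isStay x ≡ stayᵇ n b (suc m) bs x
      st′ x yx rewrite st x (<-trans (n<1+n y) yx) | dec-false (x ≟ (n + m ∸ 1)) (λ q → <-irrefl (sym (trans q e)) yx) = refl

    bSeq-S : bSeq n j S ≡ just B
    bSeq-S = subst (λ t → bSeq n t S ≡ just B) (trans (cong suc length-B′) lp)
               (bSeq-just b₁ B′ b₁-max (chain-ok b₁ 2 n B′ (n+2∸1 n) ≤-refl b₁≤n (here refl) (proj₂ B-decr)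
                                          (All.tabulate there) later (λ x _ → refl)))
      where
      later : ∀ z → z ∈ B → z < b₁ → z ∈ B′
      later z (here refl) zb = ⊥-elim (<-irrefl refl zb)
      later z (there m)   _  = m

  encode : ∀ n j ps → Nest 1 n ps → length ps ≡ j → 1 ≤ j →
    Σ (List ℕ) λ S → IsSubset n j S × take j S ≡ As ps × bSeq n j S ≡ just (Bs ps)
  encode n j ((a₁ , b₁) ∷ ps′) N lp j1 = S , isSubset , take-S , bSeq-S
    where open Encoding n j a₁ b₁ ps′ N lp
  encode n .0 [] N refl ()

module Unique where

  open ListIndex
  open Counting

  record Perm231 (n : ℕ) (f : ℕ → ℕ) : Set where
    field
      range      : ∀ i → 1 ≤ i → i ≤ n → 1 ≤ f i × f i ≤ n
      injective  : ∀ i k → 1 ≤ i → i ≤ n → 1 ≤ k → k ≤ n → f i ≡ f k → i ≡ k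
      surjective : ∀ w → 1 ≤ w → w ≤ n → Σ ℕ λ k → 1 ≤ k × k ≤ n × f k ≡ w
      avoids     : ∀ p q r → 1 ≤ p → p < q → q < r → r ≤ n → ¬ (f r < f p × f p < f q)

  ascent-below-later : ∀ {n f} → Perm231 n f → ∀ i k → 1 ≤ i → i < k → k ≤ n → ¬ (f (suc i) < f i) → f i < f k
  ascent-below-later {n} {f} P i k i1 ik kn nd with <-cmp (f i) (f (suc i))
  ... | tri≈ _ p _ =
    ⊥-elim (<-irrefl (Perm231.injective P i (suc i) i1 (≤-trans (<⇒≤ ik) kn) (s≤s z≤n) (≤-trans ik kn) p) (n<1+n i))
  ... | tri> _ _ p = ⊥-elim (nd p)
  ... | tri< s1 _ _ with m≤n⇒m<n∨m≡n ik
  ...   | inj₂ refl = s1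
  ...   | inj₁ ik′ with <-cmp (f i) (f k)
  ...     | tri< p _ _ = p
  ...     | tri≈ _ p _ = ⊥-elim (<-irrefl (Perm231.injective P i k i1 (≤-trans (<⇒≤ ik) kn) (≤-trans i1 (<⇒≤ ik)) kn p) ik)
  ...     | tri> _ _ p = ⊥-elim (Perm231.avoids P i (suc i) k i1 (n<1+n i) ik′ kn (p , s1))

  -- If f and g agree before position i, and i is an ascent of g, then f i < g i is
  -- impossible: the value f i is taken by g at some position k, which can be neither
  -- before i (f is injective) nor i itself nor after i (g i is below all later values).
  not-below-at-ascent : ∀ {n} (f g : ℕ → ℕ) → Perm231 n f → Perm231 n g → ∀ i → 1 ≤ i → i ≤ n →
    (∀ {k} → k < i → 1 ≤ k → k ≤ n → f k ≡ g k) → (i < n → ¬ (g (suc i) < g i)) → ¬ (f i < g i)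
  not-below-at-ascent f g Pf Pg i i1 i≤n agree asc lt
    with Perm231.surjective Pg (f i) (proj₁ (Perm231.range Pf i i1 i≤n)) (proj₂ (Perm231.range Pf i i1 i≤n))
  ... | (k , k1 , kn , gk) with <-cmp k i
  ... | tri< k<i _ _  = <-irrefl (Perm231.injective Pf k i k1 kn i1 i≤n (trans (agree k<i k1 kn) gk)) k<i
  ... | tri≈ _ refl _ = <-irrefl (sym gk) lt
  ... | tri> _ _ i<k  = <-asym lt (subst (g i <_) gk (ascent-below-later Pg i k i1 i<k kn (asc (<-≤-trans i<k kn))))

  perm231-unique : ∀ n (f g : ℕ → ℕ) → Perm231 n f → Perm231 n g →
    (∀ i → 1 ≤ i → i < n → g (suc i) < g i → f (suc i) < f i) →
    (∀ i → 1 ≤ i → i < n → f (suc i) < f i → f i ≡ g i) →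
    ∀ i → 1 ≤ i → i ≤ n → f i ≡ g i
  perm231-unique n f g Pf Pg same-descents agree-at-descents = <-rec (λ i → 1 ≤ i → i ≤ n → f i ≡ g i) step
    where
    at-ascent : ∀ i → (∀ {k} → k < i → 1 ≤ k → k ≤ n → f k ≡ g k) → 1 ≤ i → i ≤ n →
      (i < n → ¬ (f (suc i) < f i)) → (i < n → ¬ (g (suc i) < g i)) → f i ≡ g i
    at-ascent i agree i1 i≤n af ag with <-cmp (f i) (g i)
    ... | tri≈ _ p _  = p
    ... | tri< lt _ _ = ⊥-elim (not-below-at-ascent f g Pf Pg i i1 i≤n agree ag lt)
    ... | tri> _ _ gt = ⊥-elim (not-below-at-ascent g f Pg Pf i i1 i≤n (λ k<i k1 kn → sym (agree k<i k1 kn)) af gt)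
    step : ∀ i → (∀ {k} → k < i → 1 ≤ k → k ≤ n → f k ≡ g k) → 1 ≤ i → i ≤ n → f i ≡ g i
    step i agree i1 i≤n with i <? n
    ... | no i≮n = at-ascent i agree i1 i≤n (λ i<n → ⊥-elim (i≮n i<n)) (λ i<n → ⊥-elim (i≮n i<n))
    ... | yes i<n with f (suc i) <? f i
    ...   | yes d  = agree-at-descents i i1 i<n d
    ...   | no nd = at-ascent i agree i1 i≤n (λ _ → nd) (λ _ dg → nd (same-descents i i1 i<n dg))

  AllPairs≢-resp-↭ : ∀ {xs ys : List ℕ} → xs ↭ ys → AllPairs _≢_ xs → AllPairs _≢_ ys
  AllPairs≢-resp-↭ ↭.refl          a = a
  AllPairs≢-resp-↭ (↭.prep x p)   (h ∷ a) = All-resp-↭ p h ∷ AllPairs≢-resp-↭ p a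
  AllPairs≢-resp-↭ (↭.swap x y p) ((xy ∷ hx) ∷ (hy ∷ a)) =
    ((λ e → xy (sym e)) ∷ All-resp-↭ p hy) ∷ (All-resp-↭ p hx ∷ AllPairs≢-resp-↭ p a)
  AllPairs≢-resp-↭ (↭.trans p q)  a = AllPairs≢-resp-↭ q (AllPairs≢-resp-↭ p a)

  at-rng : ∀ lo k i → i < k → at (rng lo k) (suc i) ≡ lo + i
  at-rng lo (suc k) zero    _       = sym (+-identityʳ lo)
  at-rng lo (suc k) (suc i) (s≤s p) = trans (at-rng (suc lo) k i p) (sym (+-suc lo i))

  length-rng : ∀ lo k → length (rng lo k) ≡ k
  length-rng lo zero    = refl
  length-rng lo (suc k) = cong suc (length-rng (suc lo) k)

  range1≡rng : ∀ n → range1 n ≡ rng 1 n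
  range1≡rng n = at-ext (range1 n) (rng 1 n) (trans (length-range1 n) (sym (length-rng 1 n)))
    (λ i p → let p′ = subst (i <_) (length-range1 n) p in trans (at-range1 n i p′) (sym (at-rng 1 n i p′)))

  at-injective : ∀ xs → AllPairs _≢_ xs → ∀ i k → i < length xs → k < length xs →
    at xs (suc i) ≡ at xs (suc k) → i ≡ k
  at-injective (x ∷ xs) (h ∷ a) zero    zero    _       _       e = refl
  at-injective (x ∷ xs) (h ∷ a) zero    (suc k) _       (s≤s q) e = ⊥-elim (All.lookup h (at-∈ xs k q) e)
  at-injective (x ∷ xs) (h ∷ a) (suc i) zero    (s≤s p) _       e = ⊥-elim (All.lookup h (at-∈ xs i p) (sym e))
  at-injective (x ∷ xs) (h ∷ a) (suc i) (suc k) (s≤s p) (s≤s q) e = cong suc (at-injective xs a i k p q e)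

  module PermList (n : ℕ) (σ : List ℕ) (P : IsPerm n σ) where

    length-σ : length σ ≡ n
    length-σ = trans (↭-length P) (length-range1 n)

    entries : ∀ i → 1 ≤ i → i ≤ n → 1 ≤ at σ i × at σ i ≤ n
    entries (suc i) _ q = let (u , v) = rng-∈⁻ 1 n in-rng in u , ≤-pred v
      where
      in-rng : at σ (suc i) ∈ rng 1 n
      in-rng = subst (at σ (suc i) ∈_) (range1≡rng n) (∈-resp-↭ P (at-∈ σ i (subst (i <_) (sym length-σ) q)))

    injective : ∀ i k → 1 ≤ i → i ≤ n → 1 ≤ k → k ≤ n → at σ i ≡ at σ k → i ≡ k
    injective (suc i) (suc k) _ p _ q e =
      cong suc (at-injective σ (AllPairs≢-resp-↭ (↭-sym P) distinct) i k
                             (subst (i <_) (sym length-σ) p) (subst (k <_) (sym length-σ) q) e)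
      where
      distinct : AllPairs _≢_ (range1 n)
      distinct = subst (AllPairs _≢_) (sym (range1≡rng n)) (AllPairs.map <⇒≢ (rng-sorted 1 n))

    surjective : ∀ w → 1 ≤ w → w ≤ n → Σ ℕ λ k → 1 ≤ k × k ≤ n × at σ k ≡ w
    surjective (suc w) _ q with ∈-at σ (∈-resp-↭ (↭-sym P) w∈)
      where
      w∈ : suc w ∈ range1 n
      w∈ = subst (_∈ range1 n) (at-range1 n w q) (at-∈ (range1 n) w (subst (w <_) (sym (length-range1 n)) q))
    ... | (i , p , e) = suc i , s≤s z≤n , subst (i <_) length-σ p , e

module Surject where

  open ListIndex
  open Rotation
  open Nesting
  open Counting
  open Statistics
  open Image
  open Unique

  AllPairs-weaken : ∀ {R R′ : ℕ → ℕ → Set} {P : ℕ → Set} xs → AllPairs R xs → All P xs →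
    (∀ x y → P x → P y → R x y → R′ x y) → AllPairs R′ xs
  AllPairs-weaken []       []      []        f = []
  AllPairs-weaken (x ∷ xs) (h ∷ a) (px ∷ ps) f = All.zipWith (λ (r , py) → f x _ px py r) (h , ps) ∷ AllPairs-weaken xs a ps f

  -- Let c be a position of maximal drop, c - σ_c = j, and v = σ_c.  Of the c - 1 earlier
  -- positions at most v - 1 carry values below v, so at least j carry values above v;
  -- by 231-avoidance each of these is a descent, and as there are only j descents, the
  -- descents d₁ < … < d_j are exactly these positions.  Their values decrease, and the
  -- intervals [d_m, σ(d_m) + m - 1] form a nest whose image agrees with σ at the
  -- descents and has the same descents; by uniqueness it is σ.
  module Surjection (n j : ℕ) (σ : List ℕ) (T : IsTarget n j σ) (n1 : 1 ≤ n) (j1 : 1 ≤ j) where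

    σ-perm : IsPerm n σ
    σ-perm = proj₁ T

    open PermList n σ σ-perm

    f : ℕ → ℕ
    f = at σ

    f-perm : Perm231 n f
    f-perm = record
      { range      = entries
      ; injective  = injective
      ; surjective = surjective
      ; avoids     = λ p q r a b c d → proj₁ (proj₂ T) p q r a b c (subst (r ≤_) (sym length-σ) d)
      }

    f-avoids : ∀ p q r → 1 ≤ p → p < q → q < r → r ≤ n → ¬ (f r < f p × f p < f q)
    f-avoids = Perm231.avoids f-perm

    max-drop-at : Σ ℕ λ c → 1 ≤ c × c ≤ n × c ∸ f c ≡ j
    max-drop-at with max-attained (drops σ)
    ... | inj₁ e = ⊥-elim (<⇒≱ j1 (≤-reflexive (trans (sym (proj₂ (proj₂ (proj₂ T)))) e)))
    ... | inj₂ (i , il , e) =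
      suc i , s≤s z≤n , subst (i <_) (trans (length-drops σ) length-σ) il ,
      trans (sym (at-drops σ i (subst (i <_) (length-drops σ) il))) (trans e (proj₂ (proj₂ (proj₂ T))))

    c : ℕ
    c = proj₁ max-drop-at

    c1 : 1 ≤ c
    c1 = proj₁ (proj₂ max-drop-at)

    c≤n : c ≤ n
    c≤n = proj₁ (proj₂ (proj₂ max-drop-at))

    c-drop : c ∸ f c ≡ j
    c-drop = proj₂ (proj₂ (proj₂ max-drop-at))

    v : ℕ
    v = f c

    v1 : 1 ≤ v
    v1 = proj₁ (entries c c1 c≤n)

    v<c : v < c
    v<c with v <? c
    ... | yes p = p
    ... | no p = ⊥-elim (<⇒≱ j1 (≤-reflexive (trans (sym c-drop) (m≤n⇒m∸n≡0 (≮⇒≥ p)))))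

    j+v≡c : j + v ≡ c
    j+v≡c = trans (cong (_+ v) (sym c-drop)) (m∸n+n≡m (<⇒≤ v<c))

    c′ : ℕ
    c′ = c ∸ 1

    <c : ∀ p → p ≤ c′ → p < c
    <c p q = subst (p <_) (suc∸1 c c1) (s≤s q)

    <c≤n : ∀ p → p ≤ c′ → p ≤ n
    <c≤n p q = ≤-trans (<⇒≤ (<c p q)) c≤n

    above : ℕ → Bool
    above p = does (v <? f p)

    below : ℕ → Bool
    below p = does (f p <? v)

    above+below : cnt above c′ + cnt below c′ ≡ c′
    above+below = trans (sym (cnt-∨ above below c′ disjoint)) (cnt-all _ c′ every)
      where
      disjoint : ∀ p → above p ≡ true → below p ≡ false
      disjoint p e = dec-false (f p <? v) (λ q → <-asym q (<?-sound _ _ e))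
      every : ∀ p → 1 ≤ p → p ≤ c′ → above p ∨ below p ≡ true
      every p a b with <-cmp v (f p)
      ... | tri< q _ _ rewrite dec-true (v <? f p) q = refl
      ... | tri≈ _ q _ = ⊥-elim (<-irrefl (injective p c a (<c≤n p b) c1 c≤n (sym q)) (<c p b))
      ... | tri> _ _ q rewrite dec-true (f p <? v) q = ∨-true-right _

    below≤ : cnt below c′ ≤ v ∸ 1
    below≤ = pigeonhole c′ below f (v ∸ 1)
      (λ i a b e → proj₁ (entries i a (<c≤n i b)) , <⇒≤∸1 _ v (<?-sound _ _ e))
      (λ i i′ a b a′ b′ _ _ e → injective i i′ a (<c≤n i b) a′ (<c≤n i′ b′) e)

    j≤above : j ≤ cnt above c′
    j≤above = +-cancelʳ-≤ (v ∸ 1) j (cnt above c′)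
      (≤-trans (≤-reflexive j+v-1≡c′) (≤-trans (≤-reflexive (sym above+below)) (+-monoʳ-≤ (cnt above c′) below≤)))
      where
      j+v-1≡c′ : j + (v ∸ 1) ≡ c′
      j+v-1≡c′ = suc-injective (trans (sym (+-suc j (v ∸ 1)))
                   (trans (cong (j +_) (suc∸1 v v1)) (trans j+v≡c (sym (suc∸1 c c1)))))

    -- An earlier position with a value above v is a descent (otherwise 231 with c).
    above⇒descent : ∀ p → 1 ≤ p → p ≤ c′ → above p ≡ true → f (suc p) < f p
    above⇒descent p a b e with suc p ≟ c
    ... | yes sc = subst (λ t → f t < f p) (sym sc) (<?-sound _ _ e)
    ... | no sc with <-cmp (f p) (f (suc p))
    ...   | tri< q _ _ = ⊥-elim (f-avoids p (suc p) c a (n<1+n p) (≤∧≢⇒< (<c p b) sc) c≤n (<?-sound _ _ e , q))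
    ...   | tri≈ _ q _ =
      ⊥-elim (<-irrefl (injective p (suc p) a (<c≤n p b) (s≤s z≤n) (≤-trans (<c p b) c≤n) q) (n<1+n p))
    ...   | tri> _ _ q = q

    descent : ℕ → Bool
    descent = isDescent σ

    des≡j : cnt descent (n ∸ 1) ≡ j
    des≡j = trans (cong (λ t → cnt descent (t ∸ 1)) (sym length-σ)) (trans (sym (des≡cnt σ)) (proj₁ (proj₂ (proj₂ T))))

    good : ℕ → Bool
    good p = descent p ∧ (above p ∧ does (p <? c))

    -- Since there are at least j good positions and only j descents, every descent is good.
    descent⇒good : ∀ i → 1 ≤ i → i ≤ n ∸ 1 → descent i ≡ true → i < c × v < f i
    descent⇒good i a b e = <?-sound _ _ (proj₂ parts) , <?-sound _ _ (proj₁ parts)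
      where
      above⇒good : ∀ p → 1 ≤ p → p ≤ c′ → above p ≡ true → good p ≡ true
      above⇒good p a b e rewrite dec-true (f (suc p) <? f p) (above⇒descent p a b e) | e | dec-true (p <? c) (<c p b) = refl
      j≤good : j ≤ cnt good (n ∸ 1)
      j≤good = ≤-trans j≤above
                 (≤-trans (cnt-le above good c′ above⇒good) (cnt-mono good c′ (n ∸ 1) (∸-monoˡ-≤ 1 c≤n)))
      is-good : good i ≡ true
      is-good = cnt-le-eq good descent (n ∸ 1) (λ i _ _ e → proj₁ (∧-true (descent i) _ e))
                          (subst (_≤ cnt good (n ∸ 1)) (sym des≡j) j≤good) i a b e
      parts : above i ≡ true × does (i <? c) ≡ true
      parts = ∧-true (above i) (does (i <? c)) (proj₂ (∧-true (descent i) _ is-good))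

    D : List ℕ
    D = select descent (rng 1 (n ∸ 1))

    D-sorted : AllPairs _<_ D
    D-sorted = select-sorted descent (rng 1 (n ∸ 1)) (rng-sorted 1 (n ∸ 1))

    D-member : ∀ {d} → d ∈ D → 1 ≤ d × d ≤ n ∸ 1 × descent d ≡ true
    D-member m with select-∈⁻ descent (rng 1 (n ∸ 1)) m
    ... | (r , e) = proj₁ (rng-∈⁻ 1 (n ∸ 1) r) , ≤-pred (proj₂ (rng-∈⁻ 1 (n ∸ 1) r)) , e

    descent⇒∈D : ∀ d → 1 ≤ d → d < n → f (suc d) < f d → d ∈ D
    descent⇒∈D d a b e =
      select-∈⁺ descent (rng 1 (n ∸ 1)) (rng-∈⁺ 1 (n ∸ 1) d a (s≤s (<⇒≤∸1 d n b))) (dec-true (_ <? _) e)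

    length-D : length D ≡ j
    length-D = trans (length-select-rng descent (n ∸ 1)) des≡j

    D-good : ∀ {d} → d ∈ D → d < c × v < f d
    D-good m = let (a , b , e) = D-member m in descent⇒good _ a b e

    D<n : ∀ {d} → d ∈ D → d < n
    D<n m = ≤-<-trans (proj₁ (proj₂ (D-member m))) (∸1< n n1)

    -- Values at the descents decrease (an increase would be a 231 with c).
    D-decreasing : AllPairs (λ x y → f y < f x) D
    D-decreasing = AllPairs-weaken D D-sorted (All.tabulate (λ m → m)) decreasing
      where
      decreasing : ∀ x y → x ∈ D → y ∈ D → x < y → f y < f x
      decreasing x y mx my xy with <-cmp (f x) (f y)
      ... | tri< q _ _ = ⊥-elim (f-avoids x y c (proj₁ (D-member mx)) xy (proj₁ (D-good my)) c≤n (proj₂ (D-good mx) , q))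
      ... | tri≈ _ q _ =
        ⊥-elim (<-irrefl (injective x y (proj₁ (D-member mx)) (<⇒≤ (D<n mx)) (proj₁ (D-member my)) (<⇒≤ (D<n my)) q) xy)
      ... | tri> _ _ q = q

    intervals : ℕ → List ℕ → List (ℕ × ℕ)
    intervals k []       = []
    intervals k (d ∷ Ds) = (d , f d + k) ∷ intervals (suc k) Ds

    As-intervals : ∀ k Ds → As (intervals k Ds) ≡ Ds
    As-intervals k []       = refl
    As-intervals k (d ∷ Ds) = cong (d ∷_) (As-intervals (suc k) Ds)

    length-intervals : ∀ k Ds → length (intervals k Ds) ≡ length Ds
    length-intervals k []       = refl
    length-intervals k (d ∷ Ds) = cong suc (length-intervals (suc k) Ds)

    +-shift : ∀ a b l → a + b + suc l ≡ a + suc b + l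
    +-shift a b l = trans (+-assoc a b (suc l)) (trans (cong (a +_) (+-suc b l)) (sym (+-assoc a (suc b) l)))

    first-reaches-c : ∀ k d Ds → AllPairs (λ x y → f y < f x) (d ∷ Ds) →
      (∀ x → x ∈ d ∷ Ds → c < f x + k + length (d ∷ Ds)) → c ≤ f d + k
    first-reaches-c k d [] _ lb = ≤-pred (subst (c <_) (+-comm (f d + k) 1) (lb d (here refl)))
    first-reaches-c k d (d′ ∷ Ds) ((fd′ ∷ _) ∷ ap) lb =
      ≤-trans (first-reaches-c (suc k) d′ Ds ap (λ x m → subst (c <_) (+-shift (f x) k (suc (length Ds))) (lb x (there m))))
              (≤-trans (≤-reflexive (+-suc (f d′) k)) (+-monoˡ-≤ k fd′))

    intervals-Nest : ∀ k Ds lo hi → AllPairs _<_ Ds → AllPairs (λ x y → f y < f x) Ds → All (λ d → lo ≤ d × d < c) Ds →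
      (∀ x → x ∈ Ds → c < f x + k + length Ds) → (∀ d Ds′ → Ds ≡ d ∷ Ds′ → f d + k ≤ hi) →
      Nest lo hi (intervals k Ds)
    intervals-Nest k []       lo hi _        _                 _                 _  _  = tt
    intervals-Nest k (d ∷ Ds) lo hi (h ∷ ap) dec@(hf ∷ dec′) ((ld , dc) ∷ bnd) lb hd =
      ld , <-≤-trans dc (first-reaches-c k d Ds dec lb) , hd d Ds refl ,
      intervals-Nest (suc k) Ds (suc d) (f d + k) ap dec′ (All.zipWith (λ (dx , (_ , xc)) → dx , xc) (h , bnd))
        (λ x m → subst (c <_) (+-shift (f x) k (length Ds)) (lb x (there m)))
        (λ d′ Ds′ e → ≤-trans (≤-reflexive (+-suc (f d′) k))
                              (+-monoˡ-≤ k (All.lookup hf (subst (d′ ∈_) (sym e) (here refl)))))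

    -- R of the nest built with offset k sends every left endpoint d to f d + k: the m-th
    -- one goes to its right endpoint f d + k + m - 1, and each of the m - 1 enclosing
    -- intervals moves it one step back.
    R-intervals : ∀ k Ds lo hi → Nest lo hi (intervals k Ds) → AllPairs (λ x y → f y < f x) Ds →
      ∀ d → d ∈ Ds → R (intervals k Ds) d ≡ f d + k
    R-intervals k (d₀ ∷ Ds) lo hi (_ , ab , _ , N) _ .d₀ (here refl) = Head.head-first d₀ (f d₀ + k) (intervals (suc k) Ds) ab N
    R-intervals k (d₀ ∷ Ds) lo hi (_ , ab , _ , N) (hf ∷ dec) d (there m) =
      trans (cong (ρ d₀ (f d₀ + k)) ih)
            (trans (ρ-inside d₀ (f d₀ + k) (f d + suc k) d₀< ≤b) (cong (_∸ 1) (+-suc (f d) k)))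
      where
      ih : R (intervals (suc k) Ds) d ≡ f d + suc k
      ih = R-intervals (suc k) Ds (suc d₀) (f d₀ + k) N dec d m
      d-bounds : suc d₀ ≤ d × d < f d₀ + k
      d-bounds = All.lookup (Nest-As (suc d₀) (f d₀ + k) (intervals (suc k) Ds) N) (subst (d ∈_) (sym (As-intervals (suc k) Ds)) m)
      d₀< : d₀ < f d + suc k
      d₀< = subst (d₀ <_) ih
              (proj₁ (R-range (suc d₀) (f d₀ + k) (intervals (suc k) Ds) N d (proj₁ d-bounds) (<⇒≤ (proj₂ d-bounds))))
      ≤b : f d + suc k ≤ f d₀ + k
      ≤b = ≤-trans (≤-reflexive (+-suc (f d) k)) (+-monoˡ-≤ k (All.lookup hf m))

    ps : List (ℕ × ℕ)
    ps = intervals 0 D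

    ps-Nest : Nest 1 n ps
    ps-Nest = intervals-Nest 0 D 1 n D-sorted D-decreasing
                (All.tabulate (λ m → proj₁ (D-member m) , proj₁ (D-good m))) exceeds-c first-≤n
      where
      exceeds-c : ∀ x → x ∈ D → c < f x + 0 + length D
      exceeds-c x m = subst (λ t → c < f x + 0 + t) (sym length-D)
                        (subst (_< f x + 0 + j) (trans (+-comm v j) j+v≡c)
                               (+-monoˡ-< j (subst (v <_) (sym (+-identityʳ (f x))) (proj₂ (D-good m)))))
      first-≤n : ∀ d Ds′ → D ≡ d ∷ Ds′ → f d + 0 ≤ n
      first-≤n d Ds′ e = subst (_≤ n) (sym (+-identityʳ (f d))) (proj₂ (entries d (proj₁ (D-member d∈)) (<⇒≤ (D<n d∈))))
        where
        d∈ : d ∈ D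
        d∈ = subst (d ∈_) (sym e) (here refl)

    length-ps : length ps ≡ j
    length-ps = trans (length-intervals 0 D) length-D

    module Im = NestPermutation n ps ps-Nest

    g : ℕ → ℕ
    g = R ps

    g-perm : Perm231 n g
    g-perm = record
      { range      = λ i a b → subst (λ t → 1 ≤ t × t ≤ n) (Im.σ-at′ i a b) (T.entries i a b)
      ; injective  = λ i k a b a′ b′ e →
                       T.injective i k a b a′ b′ (trans (Im.σ-at′ i a b) (trans e (sym (Im.σ-at′ k a′ b′))))
      ; surjective = λ w a b → let (i , p , q , e) = T.surjective w a b in i , p , q , trans (sym (Im.σ-at′ i p q)) e
      ; avoids     = λ p q r _ pq qr _ (x , y) → R-avoids231 1 n ps ps-Nest p q r pq qr x y
      }
      where module T = PermList n Im.σ Im.isPerm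

    σ≡τ : ∀ i → 1 ≤ i → i ≤ n → f i ≡ g i
    σ≡τ = perm231-unique n f g f-perm g-perm same-descents agree
      where
      same-descents : ∀ i → 1 ≤ i → i < n → g (suc i) < g i → f (suc i) < f i
      same-descents i a b d =
        <?-sound _ _ (proj₂ (proj₂ (D-member (subst (i ∈_) (As-intervals 0 D) (descent⇒left-endpoint 1 n ps ps-Nest i d)))))
      agree : ∀ i → 1 ≤ i → i < n → f (suc i) < f i → f i ≡ g i
      agree i a b d = sym (trans (R-intervals 0 D 1 n ps-Nest D-decreasing i (descent⇒∈D i a b d)) (+-identityʳ (f i)))

    image≡σ : applyRots ps (range1 n) ≡ σ
    image≡σ = at-ext Im.σ σ (trans Im.length-σ (sym length-σ))
      (λ i p → let i<n = subst (i <_) Im.length-σ p in trans (Im.σ-at i i<n) (sym (σ≡τ (suc i) (s≤s z≤n) i<n)))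

open Rotation
open Nesting
open Image
open Decode
open Encode
open Surject

φ-unfold : ∀ n j S bs → bSeq n j S ≡ just bs → φ n j S ≡ applyRots (zip (aSeq j S) bs) (range1 n)
φ-unfold n j S bs e with bSeq n j S
... | just bs′ with just-injective e
...   | refl = refl
φ-unfold n j S bs () | nothing

module Decoded (n j : ℕ) (n1 : 1 ≤ n) (j1 : 1 ≤ j) (S : List ℕ) (sub : IsSubset n j S) where
  open Decoding n j S sub n1 j1 public using (A; bs; bSeq-bs; nest)
  open Decoding n j S sub n1 j1 using (length-A; length-bs)

  ps : List (ℕ × ℕ)
  ps = zip A bs

  length-ps : length ps ≡ j
  length-ps = trans (length-zipWith _,_ A bs) (trans (cong₂ _⊓_ length-A length-bs) (⊓-idem j))

  unzip-ps : unzip ps ≡ (A , bs)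
  unzip-ps = unzip-zip A bs (trans length-A (sym length-bs))

  module I = NestPermutation n ps nest

  φ≡image : φ n j S ≡ I.σ
  φ≡image = φ-unfold n j S bs bSeq-bs

φ-well-defined : ∀ n j → 1 ≤ n → 1 ≤ j → (S : List ℕ) → IsSubset n j S → WellDefined n j S
φ-well-defined n j n1 j1 S sub = bs , bSeq-bs , Nest-intervals 1 n ps nest
  where open Decoded n j n1 j1 S sub

φ-into : ∀ n j → 1 ≤ n → 1 ≤ j → (S : List ℕ) → IsSubset n j S → IsTarget n j (φ n j S)
φ-into n j n1 j1 S sub =
  subst (IsTarget n j) (sym φ≡image) (I.isPerm , I.avoids , trans I.des-σ length-ps , trans I.maxdrop-σ length-ps)
  where open Decoded n j n1 j1 S sub

-- φ is injective: the permutation determines the nest, which determines the subset.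
φ-injective : ∀ n j → 1 ≤ n → 1 ≤ j → (S T : List ℕ) → IsSubset n j S → IsSubset n j T →
  φ n j S ≡ φ n j T → S ≡ T
φ-injective n j n1 j1 S T sS sT e =
  decoding-injective n j S T n1 j1 sS sT (cong proj₁ same) (trans DS.bSeq-bs (trans (cong just (cong proj₂ same)) (sym DT.bSeq-bs)))
  where
  module DS = Decoded n j n1 j1 S sS
  module DT = Decoded n j n1 j1 T sT
  same : (DS.A , DS.bs) ≡ (DT.A , DT.bs)
  same = trans (sym DS.unzip-ps)
               (trans (cong unzip (image-injective n DS.ps DT.ps DS.nest DT.nest (trans (sym DS.φ≡image) (trans e DT.φ≡image))))
                      DT.unzip-ps)

-- φ is surjective: a target permutation is the image of a nest, which is encoded by a subset.
φ-surjective : ∀ n j → 1 ≤ n → 1 ≤ j → (σ : List ℕ) → IsTarget n j σ →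
  Σ (List ℕ) λ S → IsSubset n j S × φ n j S ≡ σ
φ-surjective n j n1 j1 σ T = S , isSubset , φS≡σ
  where
  open Surjection n j σ T n1 j1
  encoded : Σ (List ℕ) λ S → IsSubset n j S × take j S ≡ As ps × bSeq n j S ≡ just (Bs ps)
  encoded = encode n j ps ps-Nest length-ps j1
  S : List ℕ
  S = proj₁ encoded
  isSubset : IsSubset n j S
  isSubset = proj₁ (proj₂ encoded)
  take-S : take j S ≡ As ps
  take-S = proj₁ (proj₂ (proj₂ encoded))
  φS≡σ : φ n j S ≡ σ
  φS≡σ = begin
    φ n j S                                           ≡⟨ φ-unfold n j S (Bs ps) (proj₂ (proj₂ (proj₂ encoded))) ⟩
    applyRots (zip (take j S) (Bs ps)) (range1 n)     ≡⟨ cong (λ A → applyRots (zip A (Bs ps)) (range1 n)) take-S ⟩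
    applyRots (zip (As ps) (Bs ps)) (range1 n)        ≡⟨ cong (λ qs → applyRots qs (range1 n)) (zip-As-Bs ps) ⟩
    applyRots ps (range1 n)                           ≡⟨ image≡σ ⟩
    σ                                                 ∎
    where open ≡-Reasoning

proposition14 : (n j : ℕ) → 1 ≤ n → 1 ≤ j →
    ((S : List ℕ) → IsSubset n j S → WellDefined n j S)
    × ((S : List ℕ) → IsSubset n j S → IsTarget n j (φ n j S))
    × ((S T : List ℕ) → IsSubset n j S → IsSubset n j T → φ n j S ≡ φ n j T → S ≡ T)
    × ((σ : List ℕ) → IsTarget n j σ → Σ (List ℕ) λ S → IsSubset n j S × φ n j S ≡ σ)
proposition14 n j n1 j1 =
  φ-well-defined n j n1 j1 , φ-into n j n1 j1 , φ-injective n j n1 j1 , φ-surjective n j n1 j1
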